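{- Let $d,k,t$ be positive integers. For each $i\in[t]$ and $j\in[d]$ pick $x^{(i,j)}\in\mathbb{F}_2^k$ independently and uniformly at random, and for $i\in[t]$ let $T_i=\bigotimes_{j=1}^d x^{(i,j)}$. Then for every $0\le r\le t$, $$\Pr\left[\dim\mathrm{span}\{T_1,\dots,T_t\}=r\right]\le\binom{t}{r}\left(\frac{d+2^{t/k^{d-1}}}{2^k}\right)^{t-r}.$$
   Context: $\bigotimes_{j=1}^d u_j$ for $u_j\in\mathbb{F}_2^k$ is the tensor $[k]^d\to\mathbb{F}_2$, $(i_1,\dots,i_d)\mapsto u_{1,i_1}\cdots u_{d,i_d}$, viewed as a vector in $\mathbb{F}_2^{k^d}$; the span is over $\mathbb{F}_2$. -}

module Defs where

open import Data.Bool using (Bool; true; false; _∧_; _∨_; not; _xor_; if_then_else_)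
open import Data.Nat using (ℕ; zero; suc; _+_; _⊔_; _≡ᵇ_)
open import Data.Fin using (Fin)
open import Data.Vec using (Vec; []; _∷_; lookup)
open import Data.List.Base using (List; []; _∷_; [_]; map; concatMap; allFin; foldr; filterᵇ; length)
open import Data.Integer using (+_)
open import Data.Rational using (ℚ; _/_; 1ℚ; _*_)

allVecs : {A : Set} → List A → (n : ℕ) → List (Vec A n)
allVecs xs zero    = [ [] ]
allVecs xs (suc n) = concatMap (λ x → map (x ∷_) (allVecs xs n)) xs

allᵇ : {A : Set} → (A → Bool) → List A → Bool
allᵇ p = foldr (λ x b → p x ∧ b) true

-- The elements of 𝔽₂ (true = 1).
allBool : List Bool
allBool = true ∷ false ∷ []

F2^ : ℕ → Set
F2^ k = Vec Bool k

-- Tensors [k]^d → 𝔽₂, i.e. vectors in 𝔽₂^{k^d}.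
Tensor : ℕ → ℕ → Set
Tensor k d = Vec (Fin k) d → Bool

tensorProd : {k d : ℕ} → Vec (F2^ k) d → Tensor k d
tensorProd []       []       = true
tensorProd (u ∷ us) (i ∷ is) = lookup u i ∧ tensorProd us is

lincomb : {k d t : ℕ} → Vec Bool t → Vec (Tensor k d) t → Tensor k d
lincomb []       []       ι = false
lincomb (c ∷ cs) (T ∷ Ts) ι = (c ∧ T ι) xor lincomb cs Ts ι

isZero : {k d : ℕ} → Tensor k d → Bool
isZero {k} {d} T = allᵇ (λ ι → not (T ι)) (allVecs (allFin k) d)

subsetᵇ : {t : ℕ} → Vec Bool t → Vec Bool t → Bool
subsetᵇ []       []       = true
subsetᵇ (c ∷ cs) (s ∷ ss) = (not c ∨ s) ∧ subsetᵇ cs ss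

nonzeroᵇ : {t : ℕ} → Vec Bool t → Bool
nonzeroᵇ []       = false
nonzeroᵇ (c ∷ cs) = c ∨ nonzeroᵇ cs

card : {t : ℕ} → Vec Bool t → ℕ
card []       = 0
card (c ∷ cs) = (if c then 1 else 0) + card cs

independentᵇ : {k d t : ℕ} → Vec (Tensor k d) t → Vec Bool t → Bool
independentᵇ {t = t} Ts S =
  allᵇ (λ c → not (subsetᵇ c S ∧ nonzeroᵇ c) ∨ not (isZero (lincomb c Ts)))
      (allVecs allBool t)

-- dim span{T_1,…,T_t} over 𝔽₂ = maximal size of a linearly independent
-- subfamily of T_1,…,T_t (a basis of the span can be chosen among them).
dimSpan : {k d t : ℕ} → Vec (Tensor k d) t → ℕ
dimSpan {t = t} Ts =
  foldr _⊔_ 0 (map (λ S → if independentᵇ Ts S then card S else 0) (allVecs allBool t))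

Sample : ℕ → ℕ → ℕ → Set
Sample d k t = Vec (Vec (F2^ k) d) t

allSamples : (d k t : ℕ) → List (Sample d k t)
allSamples d k t = allVecs (allVecs (allVecs allBool k) d) t

tensors : {d k t : ℕ} → Sample d k t → Vec (Tensor k d) t
tensors []       = []
tensors (x ∷ xs) = tensorProd x ∷ tensors xs

-- Number of samples with dim span{T_1,…,T_t} = r, and total number of samples;
-- Pr[dim = r] = countDim / numSamples.
countDim : (d k t r : ℕ) → ℕ
countDim d k t r = length (filterᵇ (λ X → dimSpan (tensors X) ≡ᵇ r) (allSamples d k t))

numSamples : (d k t : ℕ) → ℕ
numSamples d k t = length (allSamples d k t)

ℕ→ℚ : ℕ → ℚ
ℕ→ℚ n = + n / 1

_^ℚ_ : ℚ → ℕ → ℚ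
q ^ℚ zero  = 1ℚ
q ^ℚ suc n = q * (q ^ℚ n)

module Submission where

-- If dim span{T₁,…,T_t} = r, some r of the tensors span the others, so a union bound over the (t choose r)
-- spanning sets S reduces the claim to bounding, for one subspace V of 𝔽₂^{k^d} with |V| ≤ 2^t, the number of
-- tuples (x₁,…,x_d) with x₁ ⊗ ⋯ ⊗ x_d ∈ V. At most d 2^{k(d-1)} tuples have a zero factor. For the number
-- N_d(V) of the others, N_d(V)^{k^{d-1}} ≤ |V| 2^{k(d-1) k^{d-1}} by induction on d: pick a basis y₁,…,y_k of
-- 𝔽₂^k greedily, each maximising N_{d-1}(V_y) outside the span of the previous ones, where
-- V_y = {w | y ⊗ w ∈ V}. Then N_d(V) ≤ Σ_j 2^{k-j} N_{d-1}(V_{y_j}), a dyadic sum whose k-th power is at most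
-- 2^{k²} Π_j N_{d-1}(V_{y_j}) (AM-GM plus log-convexity); the induction hypothesis bounds each factor by
-- |V_{y_j}|, and Π_j |V_{y_j}| ≤ |V| since the y_j are independent. Hence each of the t - r tensors outside S
-- has at most (d + 2^{t/k^{d-1}}) 2^{k(d-1)} choices.

open import Relation.Binary.Definitions using (DecidableEquality)

module AM-GM where

  open import Data.Nat
  open import Data.Nat.Properties
  open import Data.Nat.ListAction using (sum; product)
  open import Data.Nat.ListAction.Properties using (sum-++; product-++)
  open import Data.Nat.Tactic.RingSolver using (solve-∀)
  open import Data.List using ([]; _∷_; _++_; length; replicate)
  open import Data.List.Properties using (length-++; length-replicate)
  open import Data.Sum using (inj₁; inj₂)
  open import Data.Product using (_,_)
  open import Relation.Binary.PropositionalEquality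

  *-^-distrib : ∀ a b n → (a * b) ^ n ≡ a ^ n * b ^ n
  *-^-distrib a b zero = refl
  *-^-distrib a b (suc n) rewrite *-^-distrib a b n = interchange a b (a ^ n) (b ^ n)
    where
    interchange : ∀ a b x y → a * b * (x * y) ≡ a * x * (b * y)
    interchange = solve-∀

  2*[m*n]≤m*m+n*n : ∀ m n → 2 * (m * n) ≤ m * m + n * n
  2*[m*n]≤m*m+n*n m n with ≤-total m n
  ... | inj₁ m≤n with m≤n⇒∃[o]m+o≡n m≤n
  ...   | δ , refl = subst (2 * (m * (m + δ)) ≤_) (square m δ) (m≤m+n _ (δ * δ))
    where
    square : ∀ m δ → 2 * (m * (m + δ)) + δ * δ ≡ m * m + (m + δ) * (m + δ)
    square = solve-∀
  2*[m*n]≤m*m+n*n m n | inj₂ n≤m with m≤n⇒∃[o]m+o≡n n≤m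
  ...   | δ , refl = subst (2 * ((n + δ) * n) ≤_) (square n δ) (m≤m+n _ (δ * δ))
    where
    square : ∀ n δ → 2 * ((n + δ) * n) + δ * δ ≡ (n + δ) * (n + δ) + n * n
    square = solve-∀

  am-gm-weighted : ∀ n a b → suc n * a ^ n * b ≤ b ^ suc n + n * a ^ suc n
  am-gm-weighted zero a b = ≤-reflexive (identity b)
    where
    identity : ∀ b → 1 * 1 * b ≡ b * 1 + 0
    identity = solve-∀
  am-gm-weighted (suc n) a b = +-cancelʳ-≤ (n * (a * P) * b) _ _ (begin
    suc (suc n) * (a * P) * b + n * (a * P) * b ≡⟨ collect n a b P ⟩
    suc n * P * (2 * (a * b))                   ≤⟨ *-monoʳ-≤ (suc n * P) (2*[m*n]≤m*m+n*n a b) ⟩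
    suc n * P * (a * a + b * b)                 ≡⟨ expand n a b P ⟩
    suc n * (a * (a * P)) + suc n * P * b * b   ≤⟨ +-monoʳ-≤ (suc n * (a * (a * P))) (*-monoˡ-≤ b (am-gm-weighted n a b)) ⟩
    suc n * (a * (a * P)) + (Q + n * (a * P)) * b ≡⟨ regroup n a b P Q ⟩
    (b * Q + suc n * (a * (a * P))) + n * (a * P) * b ∎)
    where
    open ≤-Reasoning
    P = a ^ n
    Q = b ^ suc n
    collect : ∀ n a b P → suc (suc n) * (a * P) * b + n * (a * P) * b ≡ suc n * P * (2 * (a * b))
    collect = solve-∀
    expand : ∀ n a b P → suc n * P * (a * a + b * b) ≡ suc n * (a * (a * P)) + suc n * P * b * b
    expand = solve-∀
    regroup : ∀ n a b P Q → suc n * (a * (a * P)) + (Q + n * (a * P)) * b ≡ (b * Q + suc n * (a * (a * P))) + n * (a * P) * b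
    regroup = solve-∀

  -- am-gm-weighted with a = (j+2) S and b = (j+1) (x + S).
  am-gm-step : ∀ j x S → suc (suc j) ^ suc (suc j) * x * S ^ suc j ≤ suc j ^ suc j * (x + S) ^ suc (suc j)
  am-gm-step j′ x S = *-cancelˡ-≤ j (+-cancelʳ-≤ (j * ((suc j * U) * (S * V))) _ _ (begin
    j * ((suc j * U) * x * V) + j * ((suc j * U) * (S * V)) ≡⟨ lhs ⟨
    suc j * a ^ j * b                                         ≤⟨ am-gm-weighted j a b ⟩
    b ^ suc j + j * a ^ suc j                                 ≡⟨ rhs ⟩
    j * (W * ((x + S) * Z)) + j * ((suc j * U) * (S * V))     ∎))
    where
    open ≤-Reasoning
    j = suc j′
    U = suc j ^ j
    V = S ^ j
    W = j ^ j
    Z = (x + S) ^ j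
    a = suc j * S
    b = j * (x + S)
    rearrange : ∀ sj U V j x S → sj * (U * V) * (j * (x + S)) ≡ j * ((sj * U) * x * V) + j * ((sj * U) * (S * V))
    rearrange = solve-∀
    lhs : suc j * a ^ j * b ≡ j * ((suc j * U) * x * V) + j * ((suc j * U) * (S * V))
    lhs = trans (cong (λ p → suc j * p * b) (*-^-distrib (suc j) S j)) (rearrange (suc j) U V j x S)
    rhs : b ^ suc j + j * a ^ suc j ≡ j * (W * ((x + S) * Z)) + j * ((suc j * U) * (S * V))
    rhs = begin-equality
      b ^ suc j + j * a ^ suc j
        ≡⟨ cong₂ (λ p q → p + j * q) (*-^-distrib j (x + S) (suc j)) (*-^-distrib (suc j) S (suc j)) ⟩
      (j * W) * ((x + S) * Z) + j * ((suc j * U) * (S * V))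
        ≡⟨ cong (_+ j * ((suc j * U) * (S * V))) (*-assoc j W _) ⟩
      j * (W * ((x + S) * Z)) + j * ((suc j * U) * (S * V)) ∎

  am-gm : ∀ xs → length xs ^ length xs * product xs ≤ sum xs ^ length xs
  am-gm [] = ≤-refl
  am-gm (x ∷ []) = ≤-reflexive (identity x)
    where
    identity : ∀ x → 1 * 1 * (x * 1) ≡ (x + 0) * 1
    identity = solve-∀
  am-gm (x ∷ ys@(_ ∷ ys′)) = *-cancelˡ-≤ W {{m^n≢0 j j}} (begin
    W * (suc j ^ suc j * (x * product ys)) ≡⟨ rearrange W (suc j ^ suc j) x (product ys) ⟩
    suc j ^ suc j * x * (W * product ys)   ≤⟨ *-monoʳ-≤ (suc j ^ suc j * x) (am-gm ys) ⟩
    suc j ^ suc j * x * sum ys ^ j         ≤⟨ am-gm-step (length ys′) x (sum ys) ⟩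
    W * (x + sum ys) ^ suc j               ∎)
    where
    open ≤-Reasoning
    j = length ys
    W = j ^ j
    rearrange : ∀ W T x p → W * (T * (x * p)) ≡ T * x * (W * p)
    rearrange = solve-∀

  sum-replicate : ∀ n a → sum (replicate n a) ≡ n * a
  sum-replicate zero a = refl
  sum-replicate (suc n) a = cong (a +_) (sum-replicate n a)

  product-replicate : ∀ n a → product (replicate n a) ≡ a ^ n
  product-replicate zero a = refl
  product-replicate (suc n) a = cong (a *_) (product-replicate n a)

  am-gm-two-values : ∀ n m a b → (n + m) ^ (n + m) * (a ^ n * b ^ m) ≤ (n * a + m * b) ^ (n + m)
  am-gm-two-values n m a b = subst₂ _≤_ lhs rhs (am-gm xs)
    where
    xs = replicate n a ++ replicate m b
    len : length xs ≡ n + m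
    len = trans (length-++ (replicate n a)) (cong₂ _+_ (length-replicate n) (length-replicate m))
    lhs : length xs ^ length xs * product xs ≡ (n + m) ^ (n + m) * (a ^ n * b ^ m)
    lhs rewrite len | product-++ (replicate n a) (replicate m b)
              | product-replicate n a | product-replicate m b = refl
    rhs : sum xs ^ length xs ≡ (n * a + m * b) ^ (n + m)
    rhs rewrite len | sum-++ (replicate n a) (replicate m b)
              | sum-replicate n a | sum-replicate m b = refl

module DyadicSum where

  open import Data.Nat
  open import Data.Nat.Properties
  open import Data.Nat.ListAction using (product)
  open import Data.Nat.ListAction.Properties using (product-++)
  open import Data.Nat.Tactic.RingSolver using (solve-∀)
  open import Data.List using (List; []; _∷_; _++_; length; replicate)
  open import Data.List.Properties using (length-++; length-replicate; ++-assoc)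
  open import Data.List.Relation.Unary.All using (All; []; _∷_)
  open import Data.List.Relation.Unary.Linked using (Linked; []; [-]; _∷_)
  open import Data.Product using (_×_; _,_)
  open import Data.Empty using (⊥-elim)
  open import Relation.Nullary using (yes; no)
  open import Relation.Binary.PropositionalEquality
  open AM-GM

  dyadicSum : List ℕ → ℕ
  dyadicSum [] = 0
  dyadicSum (a ∷ as) = 2 ^ length as * a + dyadicSum as

  dyadicSum-++ : ∀ u v → dyadicSum (u ++ v) ≡ 2 ^ length v * dyadicSum u + dyadicSum v
  dyadicSum-++ [] v rewrite *-zeroʳ (2 ^ length v) = refl
  dyadicSum-++ (a ∷ u) v
    rewrite dyadicSum-++ u v | length-++ u {v} | ^-distribˡ-+-* 2 (length u) (length v)
    = rearrange (2 ^ length u) (2 ^ length v) a (dyadicSum u) (dyadicSum v)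
    where
    rearrange : ∀ U V a w z → U * V * a + (V * w + z) ≡ V * (U * a + w) + z
    rearrange = solve-∀

  ones : ℕ → ℕ
  ones n = dyadicSum (replicate n 1)

  ones+1≡2^n : ∀ n → ones n + 1 ≡ 2 ^ n
  ones+1≡2^n zero = refl
  ones+1≡2^n (suc n) rewrite length-replicate n {1} = begin
    2 ^ n * 1 + ones n + 1 ≡⟨ rearrange (2 ^ n) (ones n) ⟩
    2 ^ n + (ones n + 1)   ≡⟨ cong (2 ^ n +_) (ones+1≡2^n n) ⟩
    2 ^ n + 2 ^ n          ≡⟨ cong (2 ^ n +_) (+-identityʳ (2 ^ n)) ⟨
    2 ^ n + (2 ^ n + 0)    ∎
    where
    open ≡-Reasoning
    rearrange : ∀ P s → P * 1 + s + 1 ≡ P + (s + 1)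
    rearrange = solve-∀

  dyadicSum-replicate : ∀ n a → dyadicSum (replicate n a) ≡ ones n * a
  dyadicSum-replicate zero a = refl
  dyadicSum-replicate (suc n) a
    rewrite dyadicSum-replicate n a | length-replicate n {1} | length-replicate n {a}
    = rearrange (2 ^ n) (ones n) a
    where
    rearrange : ∀ P s a → P * a + s * a ≡ (P * 1 + s) * a
    rearrange = solve-∀

  -- The hypothesis says (u - v) (x - lo) < 0.
  exchange-< : ∀ {u v lo x} → lo ≤ x → u * x + v * lo < u * lo + v * x → u < v
  exchange-< {u} {v} {lo} {x} lo≤x lt with u <? v
  ... | yes u<v = u<v
  ... | no u≮v with m≤n⇒∃[o]m+o≡n (≮⇒≥ u≮v) | m≤n⇒∃[o]m+o≡n lo≤x
  ...   | ε , refl | δ , refl = ⊥-elim (<⇒≱ lt (subst ((v + ε) * lo + v * (lo + δ) ≤_) (expand v ε lo δ) (m≤m+n _ _)))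
    where
    expand : ∀ v ε lo δ → (v + ε) * lo + v * (lo + δ) + ε * δ ≡ (v + ε) * (lo + δ) + v * lo
    expand = solve-∀

  ^-cancelˡ-< : ∀ {a b} k → a ^ k < b ^ k → a < b
  ^-cancelˡ-< {a} {b} k lt with a <? b
  ... | yes a<b = a<b
  ... | no a≮b = ⊥-elim (<⇒≱ lt (^-monoˡ-≤ k (≮⇒≥ a≮b)))

  -- Comparing the bound at y with its failure at x through AM-GM on n copies of y and m copies of x.
  failure-gap : ∀ n m A B C {x y} → 0 < x → 0 < y →
    (A + B * y) ^ (n + m) ≤ C * y ^ n → C * x ^ n < (A + B * x) ^ (n + m) →
    n * A * x + m * B * x * y < n * A * y + m * B * x * x
  failure-gap n m A B C {x} {y} x>0 y>0 at-y fails-x =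
    +-cancelʳ-< (m * x * A + n * x * B * y) _ _ (subst₂ _<_ (expand₁ n m x A B y) (expand₂ n m x A B y) (^-cancelˡ-< K chain))
    where
    open ≤-Reasoning
    K = n + m
    P = A + B * x
    Q = A + B * y
    instance
      yⁿ≢0 : NonZero (y ^ n)
      yⁿ≢0 = >-nonZero (m^n>0 y {{>-nonZero y>0}} n)
      Kᴷxᵐ≢0 : NonZero (K ^ K * x ^ m)
      Kᴷxᵐ≢0 = m*n≢0 (K ^ K) (x ^ m) {{K^K≢0 K}} {{>-nonZero (m^n>0 x {{>-nonZero x>0}} m)}}
        where
        K^K≢0 : ∀ K → NonZero (K ^ K)
        K^K≢0 zero = _
        K^K≢0 (suc K) = m^n≢0 (suc K) (suc K)
    split-xᴷ : ∀ a b c d → a * (b * c) * d ≡ (a * c) * (d * b)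
    split-xᴷ = solve-∀
    swap-yⁿ : ∀ a b c → a * b * c ≡ (a * c) * b
    swap-yⁿ = solve-∀
    pull-Pᴷ : ∀ a b c d → (a * b) * (c * d) ≡ c * (a * (d * b))
    pull-Pᴷ = solve-∀
    chain : (K * x * Q) ^ K < (P * (n * y + m * x)) ^ K
    chain = begin-strict
      (K * x * Q) ^ K                         ≡⟨ trans (*-^-distrib (K * x) Q K) (cong (_* Q ^ K) (*-^-distrib K x K)) ⟩
      K ^ K * x ^ K * Q ^ K                   ≡⟨ cong (λ p → K ^ K * p * Q ^ K) (^-distribˡ-+-* x n m) ⟩
      K ^ K * (x ^ n * x ^ m) * Q ^ K         ≡⟨ split-xᴷ (K ^ K) (x ^ n) (x ^ m) (Q ^ K) ⟩
      (K ^ K * x ^ m) * (Q ^ K * x ^ n)       ≤⟨ *-monoʳ-≤ (K ^ K * x ^ m) (*-monoˡ-≤ (x ^ n) at-y) ⟩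
      (K ^ K * x ^ m) * (C * y ^ n * x ^ n)   ≡⟨ cong ((K ^ K * x ^ m) *_) (swap-yⁿ C (y ^ n) (x ^ n)) ⟩
      (K ^ K * x ^ m) * ((C * x ^ n) * y ^ n) <⟨ *-monoʳ-< (K ^ K * x ^ m) (*-monoˡ-< (y ^ n) fails-x) ⟩
      (K ^ K * x ^ m) * (P ^ K * y ^ n)       ≡⟨ pull-Pᴷ (K ^ K) (x ^ m) (P ^ K) (y ^ n) ⟩
      P ^ K * (K ^ K * (y ^ n * x ^ m))       ≤⟨ *-monoʳ-≤ (P ^ K) (am-gm-two-values n m y x) ⟩
      P ^ K * (n * y + m * x) ^ K             ≡⟨ *-^-distrib P (n * y + m * x) K ⟨
      (P * (n * y + m * x)) ^ K               ∎
    expand₁ : ∀ n m x A B y → (n + m) * x * (A + B * y) ≡ (n * A * x + m * B * x * y) + (m * x * A + n * x * B * y)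
    expand₁ = solve-∀
    expand₂ : ∀ n m x A B y → (A + B * x) * (n * y + m * x) ≡ (n * A * y + m * B * x * x) + (m * x * A + n * x * B * y)
    expand₂ = solve-∀

  -- (A + B x)^k / x^n is log-convex in x, so a bound of this shape at both ends of [lo, hi] holds in between.
  bound-interpolates : ∀ k n A B C {lo x hi} → n ≤ k → 0 < lo → lo ≤ x → x ≤ hi →
    (A + B * lo) ^ k ≤ C * lo ^ n → (A + B * hi) ^ k ≤ C * hi ^ n → (A + B * x) ^ k ≤ C * x ^ n
  bound-interpolates k n A B C {lo} {x} {hi} n≤k lo>0 lo≤x x≤hi at-lo at-hi with (A + B * x) ^ k ≤? C * x ^ n
  ... | yes holds = holds
  ... | no fails with m≤n⇒∃[o]m+o≡n n≤k
  ...   | m , refl = ⊥-elim (<-asym (exchange-< {n * A} {m * B * x} lo≤x gap-lo) (exchange-< {m * B * x} {n * A} x≤hi gap-hi))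
    where
    x>0 : 0 < x
    x>0 = <-≤-trans lo>0 lo≤x
    gap-lo : n * A * x + m * B * x * lo < n * A * lo + m * B * x * x
    gap-lo = failure-gap n m A B C x>0 lo>0 at-lo (≰⇒> fails)
    gap-hi : m * B * x * hi + n * A * x < m * B * x * x + n * A * hi
    gap-hi = subst₂ _<_ (+-comm (n * A * x) _) (+-comm (n * A * hi) _)
               (failure-gap n m A B C x>0 (<-≤-trans x>0 x≤hi) at-hi (≰⇒> fails))

  DyadicBound : ℕ → List ℕ → Set
  DyadicBound k l = dyadicSum l ^ k ≤ 2 ^ (k * k) * product l

  InRange : ℕ → ℕ → ℕ → Set
  InRange lo hi c = lo ≤ c × c ≤ hi

  module _ (L m n : ℕ) where

    dyadicSum-block : ∀ x T → dyadicSum (replicate m L ++ replicate n x ++ T) ≡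
      (2 ^ (n + length T) * (ones m * L) + dyadicSum T) + (2 ^ length T * ones n) * x
    dyadicSum-block x T
      rewrite dyadicSum-++ (replicate m L) (replicate n x ++ T) | dyadicSum-++ (replicate n x) T
            | length-++ (replicate n x) {T} | length-replicate n {x}
            | dyadicSum-replicate m L | dyadicSum-replicate n x
      = rearrange (2 ^ (n + length T)) (ones m * L) (2 ^ length T) (ones n) x (dyadicSum T)
      where
      rearrange : ∀ P a Q b x w → P * a + (Q * (b * x) + w) ≡ (P * a + w) + (Q * b) * x
      rearrange = solve-∀

    product-block : ∀ x T → product (replicate m L ++ replicate n x ++ T) ≡ (L ^ m * product T) * x ^ n
    product-block x T
      rewrite product-++ (replicate m L) (replicate n x ++ T) | product-++ (replicate n x) T
            | product-replicate m L | product-replicate n x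
      = rearrange (L ^ m) (x ^ n) (product T)
      where
      rearrange : ∀ a b c → a * (b * c) ≡ (a * c) * b
      rearrange = solve-∀

    -- Along the block of n copies of x both sides have the shape of bound-interpolates.
    block-interpolates : ∀ k T {lo x hi} → n ≤ k → 0 < lo → lo ≤ x → x ≤ hi →
      DyadicBound k (replicate m L ++ replicate n lo ++ T) → DyadicBound k (replicate m L ++ replicate n hi ++ T) →
      DyadicBound k (replicate m L ++ replicate n x ++ T)
    block-interpolates k T {lo} {x} {hi} n≤k lo>0 lo≤x x≤hi at-lo at-hi =
      from x (bound-interpolates k n A B C n≤k lo>0 lo≤x x≤hi (to lo at-lo) (to hi at-hi))
      where
      A = 2 ^ (n + length T) * (ones m * L) + dyadicSum T
      B = 2 ^ length T * ones n
      C = 2 ^ (k * k) * (L ^ m * product T)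
      lhs : ∀ y → dyadicSum (replicate m L ++ replicate n y ++ T) ^ k ≡ (A + B * y) ^ k
      lhs y = cong (_^ k) (dyadicSum-block y T)
      rhs : ∀ y → 2 ^ (k * k) * product (replicate m L ++ replicate n y ++ T) ≡ C * y ^ n
      rhs y = trans (cong (2 ^ (k * k) *_) (product-block y T)) (sym (*-assoc (2 ^ (k * k)) _ _))
      to : ∀ y → DyadicBound k (replicate m L ++ replicate n y ++ T) → (A + B * y) ^ k ≤ C * y ^ n
      to y = subst₂ _≤_ (lhs y) (rhs y)
      from : ∀ y → (A + B * y) ^ k ≤ C * y ^ n → DyadicBound k (replicate m L ++ replicate n y ++ T)
      from y = subst₂ _≤_ (sym (lhs y)) (sym (rhs y))

  replicate-++ : ∀ m n (a : ℕ) → replicate (m + n) a ≡ replicate m a ++ replicate n a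
  replicate-++ zero n a = refl
  replicate-++ (suc m) n a = cong (a ∷_) (replicate-++ m n a)

  replicate-suc-++ : ∀ n (a : ℕ) T → replicate (suc n) a ++ T ≡ replicate n a ++ a ∷ T
  replicate-suc-++ zero a T = refl
  replicate-suc-++ (suc n) a T = cong (a ∷_) (replicate-suc-++ n a T)

  DyadicBound-replicate : ∀ k L → DyadicBound k (replicate k L)
  DyadicBound-replicate k L = begin
    dyadicSum (replicate k L) ^ k ≡⟨ cong (_^ k) (dyadicSum-replicate k L) ⟩
    (ones k * L) ^ k              ≤⟨ ^-monoˡ-≤ k (*-monoˡ-≤ L ones≤2^k) ⟩
    (2 ^ k * L) ^ k               ≡⟨ *-^-distrib (2 ^ k) L k ⟩
    (2 ^ k) ^ k * L ^ k           ≡⟨ cong₂ _*_ (^-*-assoc 2 k k) (sym (product-replicate k L)) ⟩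
    2 ^ (k * k) * product (replicate k L) ∎
    where
    open ≤-Reasoning
    ones≤2^k : ones k ≤ 2 ^ k
    ones≤2^k = subst (ones k ≤_) (ones+1≡2^n k) (m≤m+n (ones k) 1)

  DyadicBound-low-high : ∀ L m n → DyadicBound (m + n + 0) (replicate m L ++ replicate n (2 ^ (m + n + 0) * L) ++ [])
  DyadicBound-low-high L m n = begin
    dyadicSum (replicate m L ++ replicate n H ++ []) ^ k  ≡⟨ cong (_^ k) (dyadicSum-block L m n H []) ⟩
    ((2 ^ (n + 0) * (a * L) + 0) + (1 * b) * H) ^ k       ≡⟨ cong (λ i → ((2 ^ i * (a * L) + 0) + (1 * b) * H) ^ k) (+-identityʳ n) ⟩
    ((2 ^ n * (a * L) + 0) + (1 * b) * H) ^ k             ≡⟨ cong (_^ k) (factor-L (2 ^ n) a b L (2 ^ k)) ⟩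
    ((2 ^ n * a + b * 2 ^ k) * L) ^ k                     ≤⟨ ^-monoˡ-≤ k (*-monoˡ-≤ L coefficient≤) ⟩
    (2 ^ n * 2 ^ k * L) ^ k                               ≡⟨ trans (*-^-distrib (2 ^ n * 2 ^ k) L k) (cong (_* L ^ k) (*-^-distrib (2 ^ n) (2 ^ k) k)) ⟩
    (2 ^ n) ^ k * (2 ^ k) ^ k * L ^ k                     ≡⟨ cong₂ (λ p q → p * (2 ^ k) ^ k * q) (2^m^n≡2^n^m n k) Lᵏ ⟩
    (2 ^ k) ^ n * (2 ^ k) ^ k * (L ^ m * L ^ n)           ≡⟨ regroup ((2 ^ k) ^ n) ((2 ^ k) ^ k) (L ^ m) (L ^ n) ⟩
    (2 ^ k) ^ k * ((L ^ m * 1) * ((2 ^ k) ^ n * L ^ n))   ≡⟨ cong₂ (λ p q → p * ((L ^ m * 1) * q)) (^-*-assoc 2 k k) (sym (*-^-distrib (2 ^ k) L n)) ⟩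
    2 ^ (k * k) * ((L ^ m * 1) * H ^ n)                   ≡⟨ cong (2 ^ (k * k) *_) (product-block L m n H []) ⟨
    2 ^ (k * k) * product (replicate m L ++ replicate n H ++ []) ∎
    where
    open ≤-Reasoning
    k = m + n + 0
    H = 2 ^ k * L
    a = ones m
    b = ones n
    factor-L : ∀ P a b L K → (P * (a * L) + 0) + (1 * b) * (K * L) ≡ (P * a + b * K) * L
    factor-L = solve-∀
    regroup : ∀ Y X a b → Y * X * (a * b) ≡ X * ((a * 1) * (Y * b))
    regroup = solve-∀
    expand : ∀ a b → (b + 1) * a + b * ((a + 1) * (b + 1)) + (b + 1) ≡ (b + 1) * ((a + 1) * (b + 1))
    expand = solve-∀
    2^m^n≡2^n^m : ∀ m n → (2 ^ m) ^ n ≡ (2 ^ n) ^ m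
    2^m^n≡2^n^m m n = trans (^-*-assoc 2 m n) (trans (cong (2 ^_) (*-comm m n)) (sym (^-*-assoc 2 n m)))
    Lᵏ : L ^ k ≡ L ^ m * L ^ n
    Lᵏ = trans (cong (L ^_) (+-identityʳ (m + n))) (^-distribˡ-+-* L m n)
    2^k≡ : 2 ^ k ≡ (a + 1) * (b + 1)
    2^k≡ = trans (cong (2 ^_) (+-identityʳ (m + n)))
             (trans (^-distribˡ-+-* 2 m n) (sym (cong₂ _*_ (ones+1≡2^n m) (ones+1≡2^n n))))
    coefficient≤ : 2 ^ n * a + b * 2 ^ k ≤ 2 ^ n * 2 ^ k
    coefficient≤ = begin
      2 ^ n * a + b * 2 ^ k                                  ≡⟨ cong₂ (λ P K → P * a + b * K) (sym (ones+1≡2^n n)) 2^k≡ ⟩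
      (b + 1) * a + b * ((a + 1) * (b + 1))                  ≤⟨ m≤m+n _ (b + 1) ⟩
      (b + 1) * a + b * ((a + 1) * (b + 1)) + (b + 1)        ≡⟨ expand a b ⟩
      (b + 1) * ((a + 1) * (b + 1))                          ≡⟨ cong₂ _*_ (ones+1≡2^n n) (sym 2^k≡) ⟩
      2 ^ n * 2 ^ k ∎

  -- Induction on the tail T: the block of n copies of x interpolates between merging it into the L-prefix
  -- (x = L) and merging it into the next entry t (x = t).
  DyadicBound-block : ∀ k L → 0 < L → ∀ T m n x → m + n + length T ≡ k → L ≤ x → x ≤ 2 ^ k * L →
    Linked _≤_ (x ∷ T) → All (InRange L (2 ^ k * L)) T → DyadicBound k (replicate m L ++ replicate n x ++ T)
  DyadicBound-block k L L>0 [] m n x refl L≤x x≤H _ _ =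
    block-interpolates L m n (m + n + 0) [] (≤-trans (m≤n+m n m) (m≤m+n (m + n) 0)) L>0 L≤x x≤H
      (subst (DyadicBound (m + n + 0)) all-L (DyadicBound-replicate (m + n + 0) L))
      (DyadicBound-low-high L m n)
    where
    all-L : replicate (m + n + 0) L ≡ replicate m L ++ replicate n L ++ []
    all-L = begin
      replicate (m + n + 0) L                 ≡⟨ replicate-++ (m + n) 0 L ⟩
      replicate (m + n) L ++ []               ≡⟨ cong (_++ []) (replicate-++ m n L) ⟩
      (replicate m L ++ replicate n L) ++ [] ≡⟨ ++-assoc (replicate m L) (replicate n L) [] ⟩
      replicate m L ++ replicate n L ++ []   ∎
      where open ≡-Reasoning
  DyadicBound-block k L L>0 (t ∷ T) m n x eq L≤x x≤H (x≤t ∷ sorted) ((L≤t , t≤H) ∷ bounds) =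
    block-interpolates L m n k (t ∷ T) n≤k L>0 L≤x x≤t x-as-L x-as-t
    where
    n≤k : n ≤ k
    n≤k = subst (n ≤_) eq (≤-trans (m≤n+m n m) (m≤m+n (m + n) _))
    shift-L : ∀ m n l → m + n + 1 + l ≡ m + n + suc l
    shift-L = solve-∀
    shift-t : ∀ m n l → m + suc n + l ≡ m + n + suc l
    shift-t = solve-∀
    len-L : m + n + 1 + length T ≡ k
    len-L = trans (shift-L m n (length T)) eq
    len-t : m + suc n + length T ≡ k
    len-t = trans (shift-t m n (length T)) eq
    merge-L : replicate (m + n) L ++ replicate 1 t ++ T ≡ replicate m L ++ replicate n L ++ t ∷ T
    merge-L = trans (cong (_++ t ∷ T) (replicate-++ m n L)) (++-assoc (replicate m L) (replicate n L) (t ∷ T))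
    x-as-L : DyadicBound k (replicate m L ++ replicate n L ++ t ∷ T)
    x-as-L = subst (DyadicBound k) merge-L (DyadicBound-block k L L>0 T (m + n) 1 t len-L L≤t t≤H sorted bounds)
    x-as-t : DyadicBound k (replicate m L ++ replicate n t ++ t ∷ T)
    x-as-t = subst (λ l → DyadicBound k (replicate m L ++ l)) (replicate-suc-++ n t T)
               (DyadicBound-block k L L>0 T m (suc n) t len-t L≤t t≤H sorted bounds)

  dyadicSum-bound : ∀ k L → 0 < L → ∀ c → length c ≡ k → Linked _≤_ c → All (InRange L (2 ^ k * L)) c →
    dyadicSum c ^ k ≤ 2 ^ (k * k) * product c
  dyadicSum-bound k L L>0 c len sorted bounds =
    DyadicBound-block k L L>0 c 0 0 L len ≤-refl (m≤n*m L (2 ^ k) {{m^n≢0 2 k}}) (L∷ c sorted bounds) bounds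
    where
    L∷ : ∀ c → Linked _≤_ c → All (InRange L (2 ^ k * L)) c → Linked _≤_ (L ∷ c)
    L∷ [] _ _ = [-]
    L∷ (a ∷ c) sorted ((L≤a , _) ∷ _) = L≤a ∷ sorted

module Counting where

  open import Data.Nat
  open import Data.Nat.Properties
  open import Data.Nat.Tactic.RingSolver using (solve-∀)
  open import Data.Bool using (Bool; true; false; _∧_; _∨_)
  open import Data.Bool.ListAction using (any)
  open import Data.List using (List; []; _∷_; _++_; length; map; concatMap; filterᵇ)
  open import Data.List.Membership.Propositional using (_∈_)
  open import Data.List.Membership.Propositional.Properties using (∈-map⁺)
  open import Data.List.Relation.Unary.Any as Any using (here; there)
  open import Data.List.Relation.Unary.Any.Properties using (concatMap⁺)
  open import Data.Vec using (Vec; []; _∷_; toList)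
  import Data.Vec
  open import Data.Product using (_×_; _,_; proj₁; proj₂; ∃)
  open import Relation.Binary.PropositionalEquality
  open import Defs using (allVecs; allᵇ)

  𝟙 : Bool → ℕ
  𝟙 true = 1
  𝟙 false = 0

  sumBy : {A : Set} → (A → ℕ) → List A → ℕ
  sumBy f [] = 0
  sumBy f (x ∷ xs) = f x + sumBy f xs

  count : {A : Set} → (A → Bool) → List A → ℕ
  count p = sumBy (λ x → 𝟙 (p x))

  𝟙-∧ : ∀ a b → 𝟙 a * 𝟙 b ≡ 𝟙 (a ∧ b)
  𝟙-∧ true b = +-identityʳ (𝟙 b)
  𝟙-∧ false b = refl

  𝟙≤1 : ∀ a → 𝟙 a ≤ 1
  𝟙≤1 true = ≤-refl
  𝟙≤1 false = z≤n

  true≢false : ∀ {a : Bool} {C : Set} → a ≡ true → a ≡ false → C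
  true≢false refl ()

  values : ∀ {A : Set} {j} → (A → ℕ) → Vec A j → List ℕ
  values f P = toList (Data.Vec.map f P)

  ∧-true : ∀ {a b} → a ∧ b ≡ true → a ≡ true × b ≡ true
  ∧-true {true} {true} _ = refl , refl

  module _ {A : Set} where

    sumBy-++ : ∀ (f : A → ℕ) xs ys → sumBy f (xs ++ ys) ≡ sumBy f xs + sumBy f ys
    sumBy-++ f [] ys = refl
    sumBy-++ f (x ∷ xs) ys rewrite sumBy-++ f xs ys = sym (+-assoc (f x) _ _)

    sumBy-cong : ∀ {f g : A → ℕ} xs → (∀ x → f x ≡ g x) → sumBy f xs ≡ sumBy g xs
    sumBy-cong [] f≡g = refl
    sumBy-cong (x ∷ xs) f≡g = cong₂ _+_ (f≡g x) (sumBy-cong xs f≡g)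

    sumBy-mono : ∀ {f g : A → ℕ} xs → (∀ x → f x ≤ g x) → sumBy f xs ≤ sumBy g xs
    sumBy-mono [] f≤g = z≤n
    sumBy-mono (x ∷ xs) f≤g = +-mono-≤ (f≤g x) (sumBy-mono xs f≤g)

    sumBy-+ : ∀ (f g : A → ℕ) xs → sumBy (λ x → f x + g x) xs ≡ sumBy f xs + sumBy g xs
    sumBy-+ f g [] = refl
    sumBy-+ f g (x ∷ xs) rewrite sumBy-+ f g xs = +-+-interchange (f x) (g x) (sumBy f xs) (sumBy g xs)
      where
      +-+-interchange : ∀ a b c d → a + b + (c + d) ≡ a + c + (b + d)
      +-+-interchange = solve-∀

    sumBy-*ˡ : ∀ c (f : A → ℕ) xs → sumBy (λ x → c * f x) xs ≡ c * sumBy f xs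
    sumBy-*ˡ c f [] = sym (*-zeroʳ c)
    sumBy-*ˡ c f (x ∷ xs) rewrite sumBy-*ˡ c f xs = sym (*-distribˡ-+ c (f x) _)

    sumBy-const : ∀ c (xs : List A) → sumBy (λ _ → c) xs ≡ c * length xs
    sumBy-const c [] = sym (*-zeroʳ c)
    sumBy-const c (x ∷ xs) rewrite sumBy-const c xs = sym (*-suc c (length xs))

    sumBy-zero : ∀ (xs : List A) → sumBy (λ _ → 0) xs ≡ 0
    sumBy-zero xs = sumBy-const 0 xs

    length≡sumBy-1 : ∀ (xs : List A) → length xs ≡ sumBy (λ _ → 1) xs
    length≡sumBy-1 [] = refl
    length≡sumBy-1 (x ∷ xs) = cong suc (length≡sumBy-1 xs)

    count≤length : ∀ (p : A → Bool) xs → count p xs ≤ length xs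
    count≤length p xs = ≤-trans (sumBy-mono xs (λ x → 𝟙≤1 (p x))) (≤-reflexive (sym (length≡sumBy-1 xs)))

    count-all : ∀ (p : A → Bool) xs → (∀ x → p x ≡ true) → count p xs ≡ length xs
    count-all p [] all-p = refl
    count-all p (x ∷ xs) all-p rewrite all-p x = cong suc (count-all p xs all-p)

    length-filterᵇ : ∀ (p : A → Bool) xs → length (filterᵇ p xs) ≡ count p xs
    length-filterᵇ p [] = refl
    length-filterᵇ p (x ∷ xs) with p x
    ... | true = cong suc (length-filterᵇ p xs)
    ... | false = length-filterᵇ p xs

    count-pos : ∀ (p : A → Bool) {a xs} → a ∈ xs → p a ≡ true → 1 ≤ count p xs
    count-pos p (here refl) pa rewrite pa = s≤s z≤n
    count-pos p {xs = x ∷ _} (there a∈xs) pa = ≤-trans (count-pos p a∈xs pa) (m≤n+m _ (𝟙 (p x)))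

    allᵇ-intro : ∀ (p : A → Bool) xs → (∀ x → p x ≡ true) → allᵇ p xs ≡ true
    allᵇ-intro p [] all-p = refl
    allᵇ-intro p (x ∷ xs) all-p rewrite all-p x = allᵇ-intro p xs all-p

    allᵇ-elim : ∀ (p : A → Bool) {x xs} → allᵇ p xs ≡ true → x ∈ xs → p x ≡ true
    allᵇ-elim p all-p (here refl) = proj₁ (∧-true all-p)
    allᵇ-elim p {xs = y ∷ _} all-p (there x∈xs) = allᵇ-elim p (proj₂ (∧-true {p y} all-p)) x∈xs

    allᵇ-false : ∀ (p : A → Bool) xs → allᵇ p xs ≡ false → ∃ λ x → p x ≡ false
    allᵇ-false p (x ∷ xs) all-p with p x in px
    ... | false = x , px
    ... | true = allᵇ-false p xs all-p

    any-intro : ∀ (p : A → Bool) {x xs} → x ∈ xs → p x ≡ true → any p xs ≡ true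
    any-intro p (here refl) px rewrite px = refl
    any-intro p {xs = y ∷ _} (there x∈xs) px with p y
    ... | true = refl
    ... | false = any-intro p x∈xs px

    any-cong : ∀ {p q : A → Bool} xs → (∀ x → p x ≡ q x) → any p xs ≡ any q xs
    any-cong [] p≡q = refl
    any-cong (x ∷ xs) p≡q = cong₂ _∨_ (p≡q x) (any-cong xs p≡q)

    any-elim : ∀ (p : A → Bool) xs → any p xs ≡ true → ∃ λ x → p x ≡ true
    any-elim p (x ∷ xs) any-p with p x in px
    ... | true = x , px
    ... | false = any-elim p xs any-p

  module _ {A B : Set} where

    sumBy-map : ∀ (f : B → ℕ) (g : A → B) xs → sumBy f (map g xs) ≡ sumBy (λ x → f (g x)) xs
    sumBy-map f g [] = refl
    sumBy-map f g (x ∷ xs) = cong (f (g x) +_) (sumBy-map f g xs)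

    sumBy-concatMap : ∀ (f : B → ℕ) (g : A → List B) xs → sumBy f (concatMap g xs) ≡ sumBy (λ x → sumBy f (g x)) xs
    sumBy-concatMap f g [] = refl
    sumBy-concatMap f g (x ∷ xs) =
      trans (sumBy-++ f (g x) (concatMap g xs)) (cong (sumBy f (g x) +_) (sumBy-concatMap f g xs))

    sumBy-swap : ∀ (f : A → B → ℕ) xs ys →
      sumBy (λ x → sumBy (λ y → f x y) ys) xs ≡ sumBy (λ y → sumBy (λ x → f x y) xs) ys
    sumBy-swap f [] ys = sym (sumBy-zero ys)
    sumBy-swap f (x ∷ xs) ys = trans (cong (sumBy (λ y → f x y) ys +_) (sumBy-swap f xs ys))
      (sym (sumBy-+ (λ y → f x y) (λ y → sumBy (λ x → f x y) xs) ys))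

    union-bound : ∀ (p : B → A → Bool) (Bs : List B) (As : List A) →
      count (λ a → any (λ b → p b a) Bs) As ≤ sumBy (λ b → count (p b) As) Bs
    union-bound p Bs As = ≤-trans (sumBy-mono As (𝟙-any≤ Bs)) (≤-reflexive (sumBy-swap (λ a b → 𝟙 (p b a)) As Bs))
      where
      𝟙-any≤ : ∀ Bs a → 𝟙 (any (λ b → p b a) Bs) ≤ sumBy (λ b → 𝟙 (p b a)) Bs
      𝟙-any≤ [] a = z≤n
      𝟙-any≤ (b ∷ Bs) a with p b a
      ... | true = s≤s z≤n
      ... | false = 𝟙-any≤ Bs a

  module _ {A : Set} where

    sumBy-allVecs-suc : ∀ (xs : List A) n (f : Vec A (suc n) → ℕ) →
      sumBy f (allVecs xs (suc n)) ≡ sumBy (λ x → sumBy (λ v → f (x ∷ v)) (allVecs xs n)) xs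
    sumBy-allVecs-suc xs n f = trans (sumBy-concatMap f (λ x → map (x ∷_) (allVecs xs n)) xs)
      (sumBy-cong xs (λ x → sumBy-map f (x ∷_) (allVecs xs n)))

    length-allVecs : ∀ (xs : List A) n → length (allVecs xs n) ≡ length xs ^ n
    length-allVecs xs zero = refl
    length-allVecs xs (suc n) = begin
      length (allVecs xs (suc n))                        ≡⟨ length≡sumBy-1 (allVecs xs (suc n)) ⟩
      sumBy (λ _ → 1) (allVecs xs (suc n))               ≡⟨ sumBy-allVecs-suc xs n (λ _ → 1) ⟩
      sumBy (λ x → sumBy (λ _ → 1) (allVecs xs n)) xs    ≡⟨ sumBy-cong xs (λ x → sym (length≡sumBy-1 (allVecs xs n))) ⟩
      sumBy (λ x → length (allVecs xs n)) xs             ≡⟨ sumBy-const (length (allVecs xs n)) xs ⟩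
      length (allVecs xs n) * length xs                  ≡⟨ cong (_* length xs) (length-allVecs xs n) ⟩
      length xs ^ n * length xs                          ≡⟨ *-comm (length xs ^ n) (length xs) ⟩
      length xs ^ suc n                                  ∎
      where open ≡-Reasoning

    ∈-allVecs : ∀ {xs : List A} → (∀ a → a ∈ xs) → ∀ {n} (v : Vec A n) → v ∈ allVecs xs n
    ∈-allVecs all∈ [] = here refl
    ∈-allVecs all∈ {suc n} (a ∷ v) =
      concatMap⁺ _ (Any.map (λ { refl → ∈-map⁺ (a ∷_) (∈-allVecs all∈ v) }) (all∈ a))

module Multiplicity {A : Set} (_≟_ : DecidableEquality A) where

  open import Data.Nat hiding (_≟_)
  open import Data.Nat.Properties hiding (_≟_)
  open import Data.Bool using (Bool; true; false)
  open import Data.Bool.ListAction using (any)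
  open import Data.List using (List; []; _∷_; length)
  open import Data.List.Membership.Propositional using (_∈_)
  open import Data.List.Relation.Unary.Any using (here; there)
  open import Data.Empty using (⊥-elim)
  open import Relation.Nullary using (does; yes; no)
  open import Relation.Nullary.Decidable using (dec-true; dec-false)
  open import Function using (_∘_)
  open import Relation.Binary.PropositionalEquality
  open Counting

  _==_ : A → A → Bool
  a == b = does (a ≟ b)

  ==-refl : ∀ a → (a == a) ≡ true
  ==-refl a = dec-true (a ≟ a) refl

  ==-sound : ∀ {a b} → (a == b) ≡ true → a ≡ b
  ==-sound {a} {b} eq with a ≟ b
  ... | yes a≡b = a≡b

  ==-complete : ∀ {a b} → a ≡ b → (a == b) ≡ true
  ==-complete {a} refl = ==-refl a

  mult : A → List A → ℕ
  mult a = count (a ==_)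

  record Enumerates (xs : List A) : Set where
    field mult≡1 : ∀ a → mult a xs ≡ 1
  open Enumerates public

  Distinct : List A → Set
  Distinct xs = ∀ a → mult a xs ≤ 1

  mult-pos⇒∈ : ∀ {a} xs → 1 ≤ mult a xs → a ∈ xs
  mult-pos⇒∈ {a} (x ∷ xs) pos with a ≟ x
  ... | yes a≡x = here a≡x
  ... | no _ = there (mult-pos⇒∈ xs pos)

  Enumerates⇒∈ : ∀ {xs} → Enumerates xs → ∀ a → a ∈ xs
  Enumerates⇒∈ {xs} enum a = mult-pos⇒∈ xs (≤-reflexive (sym (mult≡1 enum a)))

  module _ {En : List A} (enum : Enumerates En) where

    sumBy-by-mult : ∀ (f : A → ℕ) ys → sumBy f ys ≡ sumBy (λ a → mult a ys * f a) En
    sumBy-by-mult f [] = sym (sumBy-zero En)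
    sumBy-by-mult f (y ∷ ys) = begin
      f y + sumBy f ys
        ≡⟨ cong₂ _+_ (sym f-as-sum) (sumBy-by-mult f ys) ⟩
      sumBy (λ a → 𝟙 (a == y) * f a) En + sumBy (λ a → mult a ys * f a) En
        ≡⟨ sumBy-+ _ _ En ⟨
      sumBy (λ a → 𝟙 (a == y) * f a + mult a ys * f a) En
        ≡⟨ sumBy-cong En (λ a → sym (*-distribʳ-+ (f a) (𝟙 (a == y)) (mult a ys))) ⟩
      sumBy (λ a → mult a (y ∷ ys) * f a) En ∎
      where
      open ≡-Reasoning
      𝟙==-subst : ∀ a → 𝟙 (a == y) * f a ≡ f y * 𝟙 (y == a)
      𝟙==-subst a with a ≟ y
      ... | yes refl = trans (*-comm 1 (f a)) (cong (λ b → f a * 𝟙 b) (sym (==-refl a)))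
      ... | no a≢y = trans (sym (*-zeroʳ (f y))) (cong (λ b → f y * 𝟙 b) (sym (dec-false (y ≟ a) (a≢y ∘ sym))))
      f-as-sum : sumBy (λ a → 𝟙 (a == y) * f a) En ≡ f y
      f-as-sum = begin
        sumBy (λ a → 𝟙 (a == y) * f a) En ≡⟨ sumBy-cong En 𝟙==-subst ⟩
        sumBy (λ a → f y * 𝟙 (y == a)) En ≡⟨ sumBy-*ˡ (f y) _ En ⟩
        f y * mult y En                   ≡⟨ cong (f y *_) (mult≡1 enum y) ⟩
        f y * 1                           ≡⟨ *-identityʳ (f y) ⟩
        f y                               ∎

    sumBy-mono-mult : ∀ (f : A → ℕ) xs ys → (∀ a → mult a xs ≤ mult a ys) → sumBy f xs ≤ sumBy f ys
    sumBy-mono-mult f xs ys le = begin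
      sumBy f xs                          ≡⟨ sumBy-by-mult f xs ⟩
      sumBy (λ a → mult a xs * f a) En    ≤⟨ sumBy-mono En (λ a → *-monoˡ-≤ (f a) (le a)) ⟩
      sumBy (λ a → mult a ys * f a) En    ≡⟨ sumBy-by-mult f ys ⟨
      sumBy f ys                          ∎
      where open ≤-Reasoning

    length-by-mult : ∀ S → length S ≡ sumBy (λ a → mult a S) En
    length-by-mult S = trans (length≡sumBy-1 S) (trans (sumBy-by-mult (λ _ → 1) S) (sumBy-cong En (λ a → *-identityʳ _)))

    Distinct-covers : ∀ S → Distinct S → length En ≤ length S → ∀ a → 1 ≤ mult a S
    Distinct-covers S distinct long a₀ with mult a₀ S in mult≡
    ... | suc _ = s≤s z≤n
    ... | zero = ⊥-elim (<⇒≱ short long)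
      where
      open ≤-Reasoning
      ≤1 : ∀ a → mult a S + 𝟙 (a₀ == a) ≤ 1
      ≤1 a with a₀ ≟ a
      ... | yes refl rewrite mult≡ = s≤s z≤n
      ... | no _ = ≤-trans (≤-reflexive (+-identityʳ _)) (distinct a)
      short : length S < length En
      short = begin-strict
        length S                                        <⟨ m<m+n (length S) (s≤s z≤n) ⟩
        length S + 1                                    ≡⟨ cong₂ _+_ (length-by-mult S) (sym (mult≡1 enum a₀)) ⟩
        sumBy (λ a → mult a S) En + mult a₀ En          ≡⟨ sumBy-+ _ _ En ⟨
        sumBy (λ a → mult a S + 𝟙 (a₀ == a)) En         ≤⟨ sumBy-mono En ≤1 ⟩
        sumBy (λ a → 1) En                              ≡⟨ length≡sumBy-1 En ⟨
        length En                                       ∎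

    count-image≤ : ∀ {C : Set} (F : C → A) (Cs : List C) → count (λ w → any (λ c → F c == w) Cs) En ≤ length Cs
    count-image≤ F Cs = begin
      count (λ w → any (λ c → F c == w) Cs) En  ≤⟨ union-bound (λ c w → F c == w) Cs En ⟩
      sumBy (λ c → count (F c ==_) En) Cs       ≡⟨ sumBy-cong Cs (λ c → mult≡1 enum (F c)) ⟩
      sumBy (λ c → 1) Cs                        ≡⟨ length≡sumBy-1 Cs ⟨
      length Cs                                 ∎
      where open ≤-Reasoning

  count≤1 : ∀ (p : A → Bool) D → Distinct D → (∀ a b → p a ≡ true → p b ≡ true → a ≡ b) → count p D ≤ 1
  count≤1 p [] distinct p-unique = z≤n
  count≤1 p (x ∷ D) distinct p-unique with p x in px
  ... | false = count≤1 p D (λ a → ≤-trans (m≤n+m _ (𝟙 (a == x))) (distinct a)) p-unique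
  ... | true = begin
    1 + count p D         ≤⟨ +-monoʳ-≤ 1 (sumBy-mono D only-x) ⟩
    1 + mult x D          ≡⟨ cong (λ b → 𝟙 b + mult x D) (==-refl x) ⟨
    mult x (x ∷ D)        ≤⟨ distinct x ⟩
    1                     ∎
    where
    open ≤-Reasoning
    only-x : ∀ y → 𝟙 (p y) ≤ 𝟙 (x == y)
    only-x y with p y in py
    ... | false = z≤n
    ... | true rewrite p-unique x y px py = ≤-reflexive (cong 𝟙 (sym (==-refl y)))

module Enumerations where

  open import Data.Nat hiding (_≟_)
  open import Data.Nat.Properties hiding (_≟_)
  open import Data.Bool using (Bool; true; false; _∧_)
  open import Data.List using (List; []; _∷_)
  open import Data.Vec using (Vec; []; _∷_)
  open import Data.Vec.Properties using (≡-dec)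
  open import Data.Product using (_,_)
  open import Relation.Binary.PropositionalEquality
  open import Defs using (allVecs)
  open Counting

  module _ {A : Set} (_≟_ : DecidableEquality A) where
    open Multiplicity _≟_
    private module Vecs {n} = Multiplicity (≡-dec {n = n} _≟_)

    allVecs-enumerates : ∀ {xs} → Enumerates xs → ∀ n → Vecs.Enumerates (allVecs xs n)
    allVecs-enumerates {xs} enum n = record { mult≡1 = exactly-once n }
      where
      exactly-once : ∀ n (v : Vec A n) → Vecs.mult v (allVecs xs n) ≡ 1
      exactly-once zero [] = refl
      exactly-once (suc n) (a ∷ v) = begin
        sumBy (λ u → 𝟙 ((a ∷ v) Vecs.== u)) (allVecs xs (suc n))
          ≡⟨ sumBy-allVecs-suc xs n _ ⟩
        sumBy (λ x → sumBy (λ u → 𝟙 ((a == x) ∧ (v Vecs.== u))) (allVecs xs n)) xs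
          ≡⟨ sumBy-cong xs (λ x → sumBy-cong (allVecs xs n) (λ u → sym (𝟙-∧ (a == x) _))) ⟩
        sumBy (λ x → sumBy (λ u → 𝟙 (a == x) * 𝟙 (v Vecs.== u)) (allVecs xs n)) xs
          ≡⟨ sumBy-cong xs (λ x → sumBy-*ˡ (𝟙 (a == x)) _ (allVecs xs n)) ⟩
        sumBy (λ x → 𝟙 (a == x) * Vecs.mult v (allVecs xs n)) xs
          ≡⟨ sumBy-cong xs (λ x → cong (𝟙 (a == x) *_) (exactly-once n v)) ⟩
        sumBy (λ x → 𝟙 (a == x) * 1) xs
          ≡⟨ sumBy-cong xs (λ x → *-identityʳ _) ⟩
        mult a xs
          ≡⟨ mult≡1 enum a ⟩
        1 ∎
        where open ≡-Reasoning

  module _ {A B : Set} (_≟ᴬ_ : DecidableEquality A) (_≟ᴮ_ : DecidableEquality B) where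
    private
      module MA = Multiplicity _≟ᴬ_
      module MB = Multiplicity _≟ᴮ_

    count-injection : ∀ {En : List A} → MA.Enumerates En → ∀ (D : List B) → MB.Distinct D →
      (P : B → Bool) (R : A → Bool) (Φ : B → A) →
      (∀ b → P b ≡ true → R (Φ b) ≡ true) →
      (∀ a b → P a ≡ true → P b ≡ true → Φ a ≡ Φ b → a ≡ b) →
      count P D ≤ count R En
    count-injection {En} enum D distinct P R Φ maps-to injective = begin
      sumBy (λ b → 𝟙 (P b)) D
        ≡⟨ sumBy-cong D (λ b → trans (sym (*-identityʳ _)) (cong (𝟙 (P b) *_) (sym (MA.mult≡1 enum (Φ b))))) ⟩
      sumBy (λ b → 𝟙 (P b) * MA.mult (Φ b) En) D
        ≡⟨ sumBy-cong D (λ b → sym (sumBy-*ˡ (𝟙 (P b)) _ En)) ⟩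
      sumBy (λ b → sumBy (λ w → 𝟙 (P b) * 𝟙 (Φ b MA.== w)) En) D
        ≡⟨ sumBy-swap _ D En ⟩
      sumBy (λ w → sumBy (λ b → 𝟙 (P b) * 𝟙 (Φ b MA.== w)) D) En
        ≤⟨ sumBy-mono En fibre≤ ⟩
      sumBy (λ w → 𝟙 (R w)) En ∎
      where
      open ≤-Reasoning
      fibre≤ : ∀ w → sumBy (λ b → 𝟙 (P b) * 𝟙 (Φ b MA.== w)) D ≤ 𝟙 (R w)
      fibre≤ w with R w in rw
      ... | true = ≤-trans (≤-reflexive (sumBy-cong D (λ b → 𝟙-∧ (P b) _))) (MB.count≤1 _ D distinct unique)
        where
        unique : ∀ a b → (P a ∧ (Φ a MA.== w)) ≡ true → (P b ∧ (Φ b MA.== w)) ≡ true → a ≡ b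
        unique a b pa pb with ∧-true {P a} pa | ∧-true {P b} pb
        ... | Pa , Φa≡w | Pb , Φb≡w = injective a b Pa Pb (trans (MA.==-sound Φa≡w) (sym (MA.==-sound Φb≡w)))
      ... | false = ≤-trans (sumBy-mono D empty) (≤-reflexive (sumBy-zero D))
        where
        empty : ∀ b → 𝟙 (P b) * 𝟙 (Φ b MA.== w) ≤ 0
        empty b with P b in pb | Φ b MA.== w in Φb≡w
        ... | true | true with trans (sym rw) (subst (λ a → R a ≡ true) (MA.==-sound Φb≡w) (maps-to b pb))
        ...   | ()
        empty b | true | false = z≤n
        empty b | false | _ = z≤n

module F2Vectors where

  open import Data.Nat hiding (_≟_)
  open import Data.Bool using (Bool; true; false; _xor_; not)
  open import Data.Bool.Properties using (xor-same; xor-assoc; xor-comm; xor-identityˡ; xor-identityʳ)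
  import Data.Bool.Properties as Bool
  open import Data.List using (List; []; _∷_; length)
  open import Data.Vec using (Vec; []; _∷_; zipWith; replicate)
  open import Data.Vec.Properties using (≡-dec; zipWith-comm; zipWith-assoc; zipWith-identityˡ; zipWith-identityʳ)
  open import Relation.Binary.PropositionalEquality
  open import Defs using (F2^; allVecs; allBool; nonzeroᵇ)
  open Counting
  open Enumerations

  infixl 6 _⊕_
  _⊕_ : ∀ {n} → F2^ n → F2^ n → F2^ n
  _⊕_ = zipWith _xor_

  0v : ∀ {n} → F2^ n
  0v = replicate _ false

  ⊕-comm : ∀ {n} (u v : F2^ n) → u ⊕ v ≡ v ⊕ u
  ⊕-comm = zipWith-comm xor-comm

  ⊕-assoc : ∀ {n} (u v w : F2^ n) → (u ⊕ v) ⊕ w ≡ u ⊕ (v ⊕ w)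
  ⊕-assoc = zipWith-assoc xor-assoc

  ⊕-identityˡ : ∀ {n} (u : F2^ n) → 0v ⊕ u ≡ u
  ⊕-identityˡ = zipWith-identityˡ xor-identityˡ

  ⊕-identityʳ : ∀ {n} (u : F2^ n) → u ⊕ 0v ≡ u
  ⊕-identityʳ = zipWith-identityʳ xor-identityʳ

  ⊕-self : ∀ {n} (u : F2^ n) → u ⊕ u ≡ 0v
  ⊕-self [] = refl
  ⊕-self (a ∷ u) = cong₂ _∷_ (xor-same a) (⊕-self u)

  ⊕-cancel : ∀ {n} {u v : F2^ n} → u ⊕ v ≡ 0v → u ≡ v
  ⊕-cancel {u = u} {v} u⊕v≡0 = begin
    u             ≡⟨ ⊕-identityʳ u ⟨
    u ⊕ 0v        ≡⟨ cong (u ⊕_) (⊕-self v) ⟨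
    u ⊕ (v ⊕ v)   ≡⟨ ⊕-assoc u v v ⟨
    (u ⊕ v) ⊕ v   ≡⟨ cong (_⊕ v) u⊕v≡0 ⟩
    0v ⊕ v        ≡⟨ ⊕-identityˡ v ⟩
    v             ∎
    where open ≡-Reasoning

  ⊕-interchange : ∀ {n} (a b c d : F2^ n) → (a ⊕ b) ⊕ (c ⊕ d) ≡ (a ⊕ c) ⊕ (b ⊕ d)
  ⊕-interchange a b c d = begin
    (a ⊕ b) ⊕ (c ⊕ d) ≡⟨ ⊕-assoc a b (c ⊕ d) ⟩
    a ⊕ (b ⊕ (c ⊕ d)) ≡⟨ cong (a ⊕_) (⊕-assoc b c d) ⟨
    a ⊕ ((b ⊕ c) ⊕ d) ≡⟨ cong (λ x → a ⊕ (x ⊕ d)) (⊕-comm b c) ⟩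
    a ⊕ ((c ⊕ b) ⊕ d) ≡⟨ cong (a ⊕_) (⊕-assoc c b d) ⟩
    a ⊕ (c ⊕ (b ⊕ d)) ≡⟨ ⊕-assoc a c (b ⊕ d) ⟨
    (a ⊕ c) ⊕ (b ⊕ d) ∎
    where open ≡-Reasoning

  infixr 7 _·_
  _·_ : ∀ {n} → Bool → F2^ n → F2^ n
  true · v = v
  false · v = 0v

  ·-0v : ∀ {n} b → b · 0v {n} ≡ 0v
  ·-0v true = refl
  ·-0v false = refl

  ·-distribˡ-⊕ : ∀ {n} b (u v : F2^ n) → b · (u ⊕ v) ≡ b · u ⊕ b · v
  ·-distribˡ-⊕ true u v = refl
  ·-distribˡ-⊕ false u v = sym (⊕-self 0v)

  ·-distribʳ-xor : ∀ {n} a b (v : F2^ n) → (a xor b) · v ≡ a · v ⊕ b · v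
  ·-distribʳ-xor true true v = sym (⊕-self v)
  ·-distribʳ-xor true false v = sym (⊕-identityʳ v)
  ·-distribʳ-xor false b v = sym (⊕-identityˡ _)

  linComb : ∀ {j n} → F2^ j → Vec (F2^ n) j → F2^ n
  linComb [] [] = 0v
  linComb (c ∷ cs) (v ∷ vs) = c · v ⊕ linComb cs vs

  linComb-0v : ∀ {j n} (vs : Vec (F2^ n) j) → linComb 0v vs ≡ 0v
  linComb-0v [] = refl
  linComb-0v (v ∷ vs) = trans (⊕-identityˡ _) (linComb-0v vs)

  linComb-⊕ : ∀ {j n} (c d : F2^ j) (vs : Vec (F2^ n) j) → linComb (c ⊕ d) vs ≡ linComb c vs ⊕ linComb d vs
  linComb-⊕ [] [] [] = sym (⊕-self 0v)
  linComb-⊕ (a ∷ c) (b ∷ d) (v ∷ vs) = begin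
    (a xor b) · v ⊕ linComb (c ⊕ d) vs            ≡⟨ cong₂ _⊕_ (·-distribʳ-xor a b v) (linComb-⊕ c d vs) ⟩
    (a · v ⊕ b · v) ⊕ (linComb c vs ⊕ linComb d vs) ≡⟨ ⊕-interchange _ _ _ _ ⟩
    (a · v ⊕ linComb c vs) ⊕ (b · v ⊕ linComb d vs) ∎
    where open ≡-Reasoning

  Independent : ∀ {j n} → Vec (F2^ n) j → Set
  Independent vs = ∀ c → linComb c vs ≡ 0v → c ≡ 0v

  _≟ᵛ_ : ∀ {n} → DecidableEquality (F2^ n)
  _≟ᵛ_ = ≡-dec Bool._≟_

  module MultF2 {n} = Multiplicity (_≟ᵛ_ {n})
  open MultF2 public using () renaming (_==_ to _==ᵛ_)

  allF2^ : (n : ℕ) → List (F2^ n)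
  allF2^ n = allVecs allBool n

  allF2^-enumerates : ∀ n → MultF2.Enumerates (allF2^ n)
  allF2^-enumerates = allVecs-enumerates Bool._≟_ allBool-enumerates
    where
    allBool-enumerates : Multiplicity.Enumerates Bool._≟_ allBool
    allBool-enumerates = record { mult≡1 = λ { true → refl ; false → refl } }

  length-allF2^ : ∀ n → length (allF2^ n) ≡ 2 ^ n
  length-allF2^ n = length-allVecs allBool n

  nonzeroᵇ-0v : ∀ {n} → nonzeroᵇ (0v {n}) ≡ false
  nonzeroᵇ-0v {zero} = refl
  nonzeroᵇ-0v {suc n} = nonzeroᵇ-0v {n}

  nonzeroᵇ≡not[0v==] : ∀ {n} (v : F2^ n) → nonzeroᵇ v ≡ not (0v ==ᵛ v)
  nonzeroᵇ≡not[0v==] [] = refl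
  nonzeroᵇ≡not[0v==] (true ∷ v) = refl
  nonzeroᵇ≡not[0v==] (false ∷ v) = nonzeroᵇ≡not[0v==] v

module Maximum where

  open import Data.Nat
  open import Data.Nat.Properties
  open import Data.Bool using (Bool; true; false)
  open import Data.List using (List; []; _∷_)
  open import Data.List.Membership.Propositional using (_∈_)
  open import Data.List.Relation.Unary.Any using (here; there)
  open import Data.Product using (Σ; _×_; _,_)
  open import Data.Sum using (_⊎_; inj₁; inj₂)
  open import Relation.Nullary using (yes; no)
  open import Relation.Binary.PropositionalEquality
  open Counting using (true≢false)

  module _ {A : Set} (g : A → ℕ) (p : A → Bool) where

    IsMaximum : List A → A → Set
    IsMaximum xs y = p y ≡ true × (∀ {z} → z ∈ xs → p z ≡ true → g z ≤ g y)

    maximum : ∀ xs → (∀ {z} → z ∈ xs → p z ≡ false) ⊎ Σ A (IsMaximum xs)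
    maximum [] = inj₁ (λ ())
    maximum (x ∷ xs) with p x in px | maximum xs
    ... | false | inj₁ none = inj₁ λ { (here refl) → px ; (there z∈xs) → none z∈xs }
    ... | false | inj₂ (y , py , max) = inj₂ (y , py , λ { (here refl) pz → true≢false pz px ; (there z∈xs) → max z∈xs })
    ... | true | inj₁ none = inj₂ (x , px , λ { (here refl) _ → ≤-refl ; (there z∈xs) pz → true≢false pz (none z∈xs) })
    ... | true | inj₂ (y , py , max) with g y ≤? g x
    ...   | yes gy≤gx = inj₂ (x , px , λ { (here refl) _ → ≤-refl ; (there z∈xs) pz → ≤-trans (max z∈xs pz) gy≤gx })
    ...   | no gy≰gx = inj₂ (y , py , λ { (here refl) _ → <⇒≤ (≰⇒> gy≰gx) ; (there z∈xs) → max z∈xs })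

module GreedyBasis where

  open import Data.Nat hiding (_≟_)
  open import Data.Nat.Properties hiding (_≟_)
  open import Data.Bool using (Bool; true; false; not)
  open import Data.Bool.ListAction using (any)
  open import Data.List using ([]; _∷_; length; map)
  open import Data.List.Properties using (length-map)
  open import Data.List.Relation.Unary.Linked using (Linked; []; [-]; _∷_)
  open import Data.Vec using (Vec; []; _∷_)
  import Data.Vec
  open import Relation.Nullary using (contradiction)
  open import Data.Vec.Properties using (length-toList)
  open import Data.Product using (_×_; _,_; proj₁; proj₂; ∃)
  open import Data.Sum using (inj₁; inj₂)
  open import Function using (_∘_)
  open import Relation.Binary.PropositionalEquality
  open import Defs using (F2^; allBool)
  open Counting
  open F2Vectors
  open Maximum
  open DyadicSum using (dyadicSum)
  private module M {n} = MultF2 {n}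

  module _ (k : ℕ) (g : F2^ k → ℕ) where

    inSpan : ∀ {j} → Vec (F2^ k) j → F2^ k → Bool
    inSpan {j} P x = any (λ c → linComb c P ==ᵛ x) (allF2^ j)

    span-intro : ∀ {j} (P : Vec (F2^ k) j) c → inSpan P (linComb c P) ≡ true
    span-intro {j} P c = any-intro _ (M.Enumerates⇒∈ (allF2^-enumerates j) c) (M.==-refl (linComb c P))

    span-elim : ∀ {j} (P : Vec (F2^ k) j) x → inSpan P x ≡ true → ∃ λ c → linComb c P ≡ x
    span-elim {j} P x x∈span with any-elim _ (allF2^ j) x∈span
    ... | c , eq = c , M.==-sound eq

    notInSpan-shift : ∀ {j} (P : Vec (F2^ k) j) y c → inSpan P y ≡ false → inSpan P (y ⊕ linComb c P) ≡ false
    notInSpan-shift P y c y∉span with inSpan P (y ⊕ linComb c P) in shifted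
    ... | false = refl
    ... | true with span-elim P _ shifted
    ...   | d , d-gives = true≢false (subst (λ v → inSpan P v ≡ true) y≡ (span-intro P (d ⊕ c))) y∉span
      where
      open ≡-Reasoning
      y≡ : linComb (d ⊕ c) P ≡ y
      y≡ = begin
        linComb (d ⊕ c) P                      ≡⟨ linComb-⊕ d c P ⟩
        linComb d P ⊕ linComb c P              ≡⟨ cong (_⊕ linComb c P) d-gives ⟩
        (y ⊕ linComb c P) ⊕ linComb c P        ≡⟨ ⊕-assoc y _ _ ⟩
        y ⊕ (linComb c P ⊕ linComb c P)        ≡⟨ cong (y ⊕_) (⊕-self _) ⟩
        y ⊕ 0v                                 ≡⟨ ⊕-identityʳ y ⟩
        y                                      ∎

    pick : ∀ {j} → Vec (F2^ k) j → F2^ k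
    pick P with maximum g (not ∘ inSpan P) (allF2^ k)
    ... | inj₁ _ = 0v
    ... | inj₂ (y , _) = y

    basis : (j : ℕ) → Vec (F2^ k) j
    basis zero = []
    basis (suc j) = pick (basis j) ∷ basis j

    -- While j < k the span of j vectors (at most 2^j elements) misses something, so pick finds a maximum.
    pick-spec : ∀ {j} (P : Vec (F2^ k) j) → j < k →
      inSpan P (pick P) ≡ false × (∀ z → inSpan P z ≡ false → g z ≤ g (pick P))
    pick-spec {j} P j<k with maximum g (not ∘ inSpan P) (allF2^ k)
    ... | inj₂ (y , outside , max) = not-true outside , λ z z∉ → max (M.Enumerates⇒∈ (allF2^-enumerates k) z) (cong not z∉)
      where
      not-true : ∀ {b} → not b ≡ true → b ≡ false
      not-true {false} _ = refl
    ... | inj₁ none = contradiction (^-monoʳ-< 2 (s≤s (s≤s z≤n)) j<k) (≤⇒≯ 2^k≤2^j)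
      where
      open ≤-Reasoning
      not-false : ∀ {b} → not b ≡ false → b ≡ true
      not-false {true} _ = refl
      2^k≤2^j : 2 ^ k ≤ 2 ^ j
      2^k≤2^j = begin
        2 ^ k                      ≡⟨ length-allF2^ k ⟨
        length (allF2^ k)          ≡⟨ count-all (inSpan P) (allF2^ k) (λ z → not-false (none (M.Enumerates⇒∈ (allF2^-enumerates k) z))) ⟨
        count (inSpan P) (allF2^ k) ≤⟨ M.count-image≤ (allF2^-enumerates k) (λ c → linComb c P) (allF2^ j) ⟩
        length (allF2^ j)          ≡⟨ length-allF2^ j ⟩
        2 ^ j                      ∎

    basis-independent : ∀ j → j ≤ k → Independent (basis j)
    basis-independent zero _ [] _ = refl
    basis-independent (suc j) j<k (true ∷ c) combination≡0 =
      true≢false (subst (λ v → inSpan (basis j) v ≡ true) (sym (⊕-cancel combination≡0)) (span-intro (basis j) c))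
                 (proj₁ (pick-spec (basis j) j<k))
    basis-independent (suc j) j<k (false ∷ c) combination≡0 =
      cong (false ∷_) (basis-independent j (<⇒≤ j<k) c (trans (sym (⊕-identityˡ _)) combination≡0))

    -- The 2^j combinations involving the newest vector y are all outside the old span, so each has g-value at most g y.
    sum-over-span≤dyadicSum : g 0v ≡ 0 → ∀ j → j ≤ k →
      sumBy (λ c → g (linComb c (basis j))) (allF2^ j) ≤ dyadicSum (values g (basis j))
    sum-over-span≤dyadicSum g0≡0 zero _ rewrite g0≡0 = z≤n
    sum-over-span≤dyadicSum g0≡0 (suc j) j<k = begin
      sumBy (λ c → g (linComb c (y ∷ P))) (allF2^ (suc j))
        ≡⟨ sumBy-allVecs-suc allBool j _ ⟩
      sumBy (λ c → g (y ⊕ linComb c P)) (allF2^ j) + (sumBy (λ c → g (0v ⊕ linComb c P)) (allF2^ j) + 0)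
        ≤⟨ +-mono-≤ new old ⟩
      2 ^ j * g y + dyadicSum (values g P)
        ≡⟨ cong (λ i → 2 ^ i * g y + dyadicSum (values g P)) (length-toList (Data.Vec.map g P)) ⟨
      dyadicSum (values g (y ∷ P)) ∎
      where
      open ≤-Reasoning
      P = basis j
      y = pick P
      new : sumBy (λ c → g (y ⊕ linComb c P)) (allF2^ j) ≤ 2 ^ j * g y
      new = begin
        sumBy (λ c → g (y ⊕ linComb c P)) (allF2^ j)
          ≤⟨ sumBy-mono (allF2^ j) (λ c → proj₂ (pick-spec P j<k) _ (notInSpan-shift P y c (proj₁ (pick-spec P j<k)))) ⟩
        sumBy (λ c → g y) (allF2^ j)   ≡⟨ sumBy-const (g y) (allF2^ j) ⟩
        g y * length (allF2^ j)        ≡⟨ cong (g y *_) (length-allF2^ j) ⟩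
        g y * 2 ^ j                    ≡⟨ *-comm (g y) _ ⟩
        2 ^ j * g y                    ∎
      old : sumBy (λ c → g (0v ⊕ linComb c P)) (allF2^ j) + 0 ≤ dyadicSum (values g P)
      old = begin
        sumBy (λ c → g (0v ⊕ linComb c P)) (allF2^ j) + 0  ≡⟨ +-identityʳ _ ⟩
        sumBy (λ c → g (0v ⊕ linComb c P)) (allF2^ j)      ≡⟨ sumBy-cong (allF2^ j) (λ c → cong g (⊕-identityˡ _)) ⟩
        sumBy (λ c → g (linComb c P)) (allF2^ j)           ≤⟨ sum-over-span≤dyadicSum g0≡0 j (<⇒≤ j<k) ⟩
        dyadicSum (values g P)                             ∎

    values-sorted : ∀ j → j ≤ k → Linked _≤_ (values g (basis j))
    values-sorted zero _ = []
    values-sorted (suc zero) _ = [-]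
    values-sorted (suc (suc j)) j<k = later≤earlier ∷ values-sorted (suc j) (<⇒≤ j<k)
      where
      P = basis j
      y = pick P
      y′ = pick (y ∷ P)
      y′∉span : inSpan P y′ ≡ false
      y′∉span with inSpan P y′ in y′∈span
      ... | false = refl
      ... | true with span-elim P y′ y′∈span
      ...   | c , c-gives = true≢false
                (subst (λ v → inSpan (y ∷ P) v ≡ true) (trans (⊕-identityˡ _) c-gives) (span-intro (y ∷ P) (false ∷ c)))
                (proj₁ (pick-spec (y ∷ P) j<k))
      later≤earlier : g y′ ≤ g y
      later≤earlier = proj₂ (pick-spec P (<⇒≤ j<k)) y′ y′∉span

    -- k independent vectors of 𝔽₂^k have 2^k distinct combinations, which therefore exhaust 𝔽₂^k.
    sum≤sum-over-span : sumBy g (allF2^ k) ≤ sumBy (λ c → g (linComb c (basis k))) (allF2^ k)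
    sum≤sum-over-span = begin
      sumBy g (allF2^ k)                                ≤⟨ M.sumBy-mono-mult (allF2^-enumerates k) g (allF2^ k) span every∈span ⟩
      sumBy g span                                      ≡⟨ sumBy-map g (λ c → linComb c (basis k)) (allF2^ k) ⟩
      sumBy (λ c → g (linComb c (basis k))) (allF2^ k)  ∎
      where
      open ≤-Reasoning
      span = map (λ c → linComb c (basis k)) (allF2^ k)
      distinct : M.Distinct span
      distinct a = begin
        M.mult a span
          ≡⟨ sumBy-map _ (λ c → linComb c (basis k)) (allF2^ k) ⟩
        count (λ c → a ==ᵛ linComb c (basis k)) (allF2^ k)
          ≤⟨ M.count≤1 _ (allF2^ k) (λ c → ≤-reflexive (M.mult≡1 (allF2^-enumerates k) c)) unique ⟩
        1 ∎
        where
        unique : ∀ c d → (a ==ᵛ linComb c (basis k)) ≡ true → (a ==ᵛ linComb d (basis k)) ≡ true → c ≡ d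
        unique c d a≡c a≡d = ⊕-cancel (basis-independent k ≤-refl (c ⊕ d)
          (trans (linComb-⊕ c d (basis k)) (trans (cong₂ _⊕_ (sym (M.==-sound a≡c)) (sym (M.==-sound a≡d))) (⊕-self a))))
      every∈span : ∀ a → M.mult a (allF2^ k) ≤ M.mult a span
      every∈span a = ≤-trans (≤-reflexive (M.mult≡1 (allF2^-enumerates k) a))
        (M.Distinct-covers (allF2^-enumerates k) span distinct
          (≤-reflexive (trans (length-allF2^ k) (sym (trans (length-map _ (allF2^ k)) (length-allF2^ k))))) a)

    greedy-basis : g 0v ≡ 0 →
      Independent (basis k) × sumBy g (allF2^ k) ≤ dyadicSum (values g (basis k)) × Linked _≤_ (values g (basis k))
    greedy-basis g0≡0 =
      basis-independent k ≤-refl ,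
      ≤-trans sum≤sum-over-span (sum-over-span≤dyadicSum g0≡0 k ≤-refl) ,
      values-sorted k ≤-refl

module TensorProduct where

  open import Data.Nat hiding (_≟_)
  open import Data.Bool using (Bool; true; false; _∧_; _xor_)
  open import Data.Bool.Properties using (∧-comm)
  open import Data.Fin using (Fin; zero; suc)
  open import Data.Vec using (Vec; []; _∷_; _++_; lookup; map; head; tail; zipWith; replicate)
  open import Data.Vec.Properties using (++-injectiveˡ; ++-injectiveʳ; lookup-zipWith; lookup-replicate; tabulate∘lookup; tabulate-cong)
  open import Relation.Binary.PropositionalEquality
  open import Defs using (F2^)
  open F2Vectors

  infixr 7 _⊗_
  _⊗_ : ∀ {k n} → F2^ k → F2^ n → F2^ (k * n)
  [] ⊗ w = []
  (b ∷ x) ⊗ w = b · w ++ x ⊗ w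

  ⨂ : ∀ {k d} → Vec (F2^ k) d → F2^ (k ^ d)
  ⨂ [] = true ∷ []
  ⨂ (x ∷ xs) = x ⊗ ⨂ xs

  0v-++ : ∀ m n → 0v {m + n} ≡ 0v {m} ++ 0v {n}
  0v-++ zero n = refl
  0v-++ (suc m) n = cong (false ∷_) (0v-++ m n)

  ⊕-++ : ∀ {m n} (a c : F2^ m) (b d : F2^ n) → (a ++ b) ⊕ (c ++ d) ≡ (a ⊕ c) ++ (b ⊕ d)
  ⊕-++ [] [] b d = refl
  ⊕-++ (x ∷ a) (y ∷ c) b d = cong ((x xor y) ∷_) (⊕-++ a c b d)

  ⊗-0v : ∀ {k n} (x : F2^ k) → x ⊗ 0v {n} ≡ 0v
  ⊗-0v [] = refl
  ⊗-0v {suc k} {n} (b ∷ x) = trans (cong₂ _++_ (·-0v b) (⊗-0v x)) (sym (0v-++ n (k * n)))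

  ⊗-distribˡ-⊕ : ∀ {k n} (x : F2^ k) (u v : F2^ n) → x ⊗ (u ⊕ v) ≡ x ⊗ u ⊕ x ⊗ v
  ⊗-distribˡ-⊕ [] u v = refl
  ⊗-distribˡ-⊕ (b ∷ x) u v =
    trans (cong₂ _++_ (·-distribˡ-⊕ b u v) (⊗-distribˡ-⊕ x u v)) (sym (⊕-++ (b · u) (b · v) (x ⊗ u) (x ⊗ v)))

  ⊗[1]-injective : ∀ {k} (x x′ : F2^ k) → x ⊗ (true ∷ []) ≡ x′ ⊗ (true ∷ []) → x ≡ x′
  ⊗[1]-injective [] [] eq = refl
  ⊗[1]-injective (true ∷ x) (true ∷ x′) eq = cong (true ∷_) (⊗[1]-injective x x′ (cong tail eq))
  ⊗[1]-injective (false ∷ x) (false ∷ x′) eq = cong (false ∷_) (⊗[1]-injective x x′ (cong tail eq))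
  ⊗[1]-injective (true ∷ x) (false ∷ x′) ()
  ⊗[1]-injective (false ∷ x) (true ∷ x′) ()

  Σ⊗ : ∀ {k n j} → Vec (F2^ k) j → Vec (F2^ n) j → F2^ (k * n)
  Σ⊗ [] [] = 0v
  Σ⊗ (y ∷ P) (u ∷ U) = y ⊗ u ⊕ Σ⊗ P U

  Σ⊗-⊕ : ∀ {k n j} (P : Vec (F2^ k) j) (U V : Vec (F2^ n) j) → Σ⊗ P (zipWith _⊕_ U V) ≡ Σ⊗ P U ⊕ Σ⊗ P V
  Σ⊗-⊕ [] [] [] = sym (⊕-self 0v)
  Σ⊗-⊕ (y ∷ P) (u ∷ U) (v ∷ V) = trans (cong₂ _⊕_ (⊗-distribˡ-⊕ y u v) (Σ⊗-⊕ P U V)) (⊕-interchange _ _ _ _)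

  column : ∀ {k j} → Fin k → Vec (F2^ k) j → F2^ j
  column i P = map (λ y → lookup y i) P

  Σ⊗-split : ∀ {k n j} (P : Vec (F2^ (suc k)) j) (U : Vec (F2^ n) j) →
    Σ⊗ P U ≡ linComb (column zero P) U ++ Σ⊗ (map tail P) U
  Σ⊗-split {k} {n} [] [] = 0v-++ n (k * n)
  Σ⊗-split ((b ∷ y) ∷ P) (u ∷ U) = trans (cong (λ v → (b · u ++ y ⊗ u) ⊕ v) (Σ⊗-split P U))
    (⊕-++ (b · u) (linComb (column zero P) U) (y ⊗ u) (Σ⊗ (map tail P) U))

  column-suc : ∀ {k j} (i : Fin k) (P : Vec (F2^ (suc k)) j) → column (suc i) P ≡ column i (map tail P)
  column-suc i [] = refl
  column-suc i ((b ∷ y) ∷ P) = cong (lookup y i ∷_) (column-suc i P)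

  -- Block i of Σ⊗ P U is the combination of U with coefficients column i P.
  Σ⊗≡0⇒blocks≡0 : ∀ {k n j} (P : Vec (F2^ k) j) (U : Vec (F2^ n) j) → Σ⊗ P U ≡ 0v → ∀ i → linComb (column i P) U ≡ 0v
  Σ⊗≡0⇒blocks≡0 {suc k} {n} P U eq zero =
    ++-injectiveˡ _ _ (trans (sym (Σ⊗-split P U)) (trans eq (0v-++ n (k * n))))
  Σ⊗≡0⇒blocks≡0 {suc k} {n} P U eq (suc i) rewrite column-suc i P =
    Σ⊗≡0⇒blocks≡0 (map tail P) U (++-injectiveʳ _ _ (trans (sym (Σ⊗-split P U)) (trans eq (0v-++ n (k * n))))) i

  dot : ∀ {j} → F2^ j → F2^ j → Bool
  dot [] [] = false
  dot (a ∷ c) (b ∷ d) = (a ∧ b) xor dot c d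

  dot-comm : ∀ {j} (c d : F2^ j) → dot c d ≡ dot d c
  dot-comm [] [] = refl
  dot-comm (a ∷ c) (b ∷ d) = cong₂ _xor_ (∧-comm a b) (dot-comm c d)

  lookup-· : ∀ {n} a (u : F2^ n) p → lookup (a · u) p ≡ a ∧ lookup u p
  lookup-· true u p = refl
  lookup-· false u p = lookup-replicate p false

  lookup-linComb : ∀ {n j} (c : F2^ j) (U : Vec (F2^ n) j) p → lookup (linComb c U) p ≡ dot c (column p U)
  lookup-linComb [] [] p = lookup-replicate p false
  lookup-linComb (a ∷ c) (u ∷ U) p =
    trans (lookup-zipWith _xor_ p (a · u) (linComb c U)) (cong₂ _xor_ (lookup-· a u p) (lookup-linComb c U p))

  lookup-extensional : ∀ {A : Set} {n} (u v : Vec A n) → (∀ p → lookup u p ≡ lookup v p) → u ≡ v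
  lookup-extensional u v same = trans (sym (tabulate∘lookup u)) (trans (tabulate-cong same) (tabulate∘lookup v))

  columns≡0 : ∀ {k j} (U : Vec (F2^ k) j) → (∀ p → column p U ≡ 0v) → U ≡ replicate j 0v
  columns≡0 [] all≡0 = refl
  columns≡0 (u ∷ U) all≡0 =
    cong₂ _∷_ (lookup-extensional u 0v (λ p → trans (cong head (all≡0 p)) (sym (lookup-replicate p false))))
              (columns≡0 U (λ p → cong tail (all≡0 p)))

  -- Σ⊗ P U ≡ 0 says P Uᵀ = 0 as a k × n matrix; independence of the rows of P kills every column of U.
  Σ⊗-kernel : ∀ {k n j} (P : Vec (F2^ k) j) → Independent P → (U : Vec (F2^ n) j) → Σ⊗ P U ≡ 0v → U ≡ replicate j 0v
  Σ⊗-kernel P independent U eq = columns≡0 U column≡0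
    where
    open ≡-Reasoning
    column≡0 : ∀ p → column p U ≡ 0v
    column≡0 p = independent (column p U) (lookup-extensional _ _ λ i → begin
      lookup (linComb (column p U) P) i   ≡⟨ lookup-linComb (column p U) P i ⟩
      dot (column p U) (column i P)       ≡⟨ dot-comm (column p U) (column i P) ⟩
      dot (column i P) (column p U)       ≡⟨ lookup-linComb (column i P) U p ⟨
      lookup (linComb (column i P) U) p   ≡⟨ cong (λ v → lookup v p) (Σ⊗≡0⇒blocks≡0 P U eq i) ⟩
      lookup 0v p                         ≡⟨ lookup-replicate p false ⟩
      false                               ≡⟨ lookup-replicate i false ⟨
      lookup 0v i                         ∎)

  Σ⊗-injective : ∀ {k n j} (P : Vec (F2^ k) j) → Independent P → (U V : Vec (F2^ n) j) → Σ⊗ P U ≡ Σ⊗ P V → U ≡ V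
  Σ⊗-injective P independent U V eq = pointwise-cancel U V (Σ⊗-kernel P independent (zipWith _⊕_ U V)
    (trans (Σ⊗-⊕ P U V) (trans (cong (_⊕ Σ⊗ P V) eq) (⊕-self _))))
    where
    pointwise-cancel : ∀ {n j} (U V : Vec (F2^ n) j) → zipWith _⊕_ U V ≡ replicate j 0v → U ≡ V
    pointwise-cancel [] [] eq = refl
    pointwise-cancel (u ∷ U) (v ∷ V) eq = cong₂ _∷_ (⊕-cancel (cong head eq)) (pointwise-cancel U V (cong tail eq))

module ProductsInSubspaces where

  open import Data.Nat hiding (_≟_)
  open import Data.Nat.Properties hiding (_≟_)
  open import Data.Nat.ListAction using (product)
  open import Data.Nat.Tactic.RingSolver using (solve-∀)
  open import Data.Bool using (Bool; true; false; _∧_; if_then_else_)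
  open import Data.List using ([]; _∷_)
  open import Data.List.Relation.Unary.All using (All; []; _∷_)
  open import Data.List.Relation.Unary.Linked using (Linked; []; [-]; _∷_)
  open import Data.Vec using (Vec; []; _∷_)
  import Data.Vec
  open import Data.Vec.Properties using (length-toList; ≡-dec)
  open import Data.Product using (_×_; _,_; proj₁; proj₂)
  open import Data.Sum using (inj₁; inj₂)
  open import Function using (_∘_)
  open import Relation.Binary.PropositionalEquality
  open import Defs using (F2^; allVecs; nonzeroᵇ)
  open AM-GM using (*-^-distrib)
  open DyadicSum
  open Counting
  open Enumerations
  open F2Vectors
  open TensorProduct
  private module M {n} = MultF2 {n}

  module _ {A : Set} where

    product-values-^ : ∀ {j} (f : A → ℕ) (P : Vec A j) m → product (values f P) ^ m ≡ product (values (λ y → f y ^ m) P)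
    product-values-^ f [] m = ^-zeroˡ m
    product-values-^ f (y ∷ P) m = trans (*-^-distrib (f y) _ m) (cong (f y ^ m *_) (product-values-^ f P m))

    product-values-mono : ∀ {j} {f f′ : A → ℕ} (P : Vec A j) → (∀ y → f y ≤ f′ y) → product (values f P) ≤ product (values f′ P)
    product-values-mono [] f≤f′ = ≤-refl
    product-values-mono (y ∷ P) f≤f′ = *-mono-≤ (f≤f′ y) (product-values-mono P f≤f′)

    product-values-*ʳ : ∀ {j} (f : A → ℕ) c (P : Vec A j) → product (values (λ y → f y * c) P) ≡ product (values f P) * c ^ j
    product-values-*ʳ f c [] = refl
    product-values-*ʳ {suc j} f c (y ∷ P) rewrite product-values-*ʳ f c P = rearrange (f y) c (product (values f P)) (c ^ j)
      where
      rearrange : ∀ a c p q → a * c * (p * q) ≡ a * p * (c * q)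
      rearrange = solve-∀

    dyadicSum-values-mono : ∀ {j} {f f′ : A → ℕ} (P : Vec A j) → (∀ y → f y ≤ f′ y) → dyadicSum (values f P) ≤ dyadicSum (values f′ P)
    dyadicSum-values-mono [] f≤f′ = ≤-refl
    dyadicSum-values-mono {suc j} {f} {f′} (y ∷ P) f≤f′ rewrite length-toList (Data.Vec.map f P) | length-toList (Data.Vec.map f′ P) =
      +-mono-≤ (*-monoʳ-≤ (2 ^ j) (f≤f′ y)) (dyadicSum-values-mono P f≤f′)

    Linked-values-map : ∀ {j} (f : A → ℕ) (φ : ℕ → ℕ) (P : Vec A j) → (∀ {a b} → a ≤ b → φ a ≤ φ b) →
      Linked _≤_ (values f P) → Linked _≤_ (values (φ ∘ f) P)
    Linked-values-map f φ [] φ-mono sorted = []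
    Linked-values-map f φ (y ∷ []) φ-mono sorted = [-]
    Linked-values-map f φ (y ∷ y′ ∷ P) φ-mono (le ∷ sorted) = φ-mono le ∷ Linked-values-map f φ (y′ ∷ P) φ-mono sorted

    All-values : ∀ {j} (f : A → ℕ) {Q : ℕ → Set} (P : Vec A j) → (∀ y → Q (f y)) → All Q (values f P)
    All-values f [] Qf = []
    All-values f (y ∷ P) Qf = Qf y ∷ All-values f P Qf

  IsSubspace : ∀ {n} → (F2^ n → Bool) → Set
  IsSubspace V = V 0v ≡ true × (∀ a b → V a ≡ true → V b ≡ true → V (a ⊕ b) ≡ true)

  size : ∀ {n} → (F2^ n → Bool) → ℕ
  size {n} V = count V (allF2^ n)

  slice : ∀ {k n} → (F2^ (k * n) → Bool) → F2^ k → F2^ n → Bool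
  slice V x w = V (x ⊗ w)

  slice-subspace : ∀ {k n} (V : F2^ (k * n) → Bool) → IsSubspace V → ∀ x → IsSubspace (slice {k} {n} V x)
  slice-subspace V (V∋0 , V-closed) x =
    subst (λ v → V v ≡ true) (sym (⊗-0v x)) V∋0 ,
    λ a b Va Vb → subst (λ v → V v ≡ true) (sym (⊗-distribˡ-⊕ x a b)) (V-closed _ _ Va Vb)

  size-pos : ∀ {n} (V : F2^ n → Bool) → IsSubspace V → 1 ≤ size V
  size-pos {n} V (V∋0 , _) = count-pos V (M.Enumerates⇒∈ (allF2^-enumerates n) 0v) V∋0

  allNonzero : ∀ {k d} → Vec (F2^ k) d → Bool
  allNonzero [] = true
  allNonzero (x ∷ xs) = nonzeroᵇ x ∧ allNonzero xs

  nonzeroHits : ∀ k d → (F2^ (k ^ d) → Bool) → ℕ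
  nonzeroHits k d V = count (λ xs → allNonzero xs ∧ V (⨂ xs)) (allVecs (allF2^ k) d)

  sliceHits : ∀ k d → (F2^ (k ^ suc d) → Bool) → F2^ k → ℕ
  sliceHits k d V x = if nonzeroᵇ x then nonzeroHits k d (slice V x) else 0

  nonzeroHits-suc : ∀ k d (V : F2^ (k ^ suc d) → Bool) → nonzeroHits k (suc d) V ≡ sumBy (sliceHits k d V) (allF2^ k)
  nonzeroHits-suc k d V = trans (sumBy-allVecs-suc (allF2^ k) d _) (sumBy-cong (allF2^ k) by-first-factor)
    where
    by-first-factor : ∀ x → sumBy (λ xs → 𝟙 ((nonzeroᵇ x ∧ allNonzero xs) ∧ V (x ⊗ ⨂ xs))) (allVecs (allF2^ k) d) ≡ sliceHits k d V x
    by-first-factor x with nonzeroᵇ x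
    ... | true = refl
    ... | false = sumBy-zero (allVecs (allF2^ k) d)

  nonzeroHits≤ : ∀ k d (V : F2^ (k ^ d) → Bool) → nonzeroHits k d V ≤ (2 ^ k) ^ d
  nonzeroHits≤ k d V = ≤-trans (count≤length _ (allVecs (allF2^ k) d))
    (≤-reflexive (trans (length-allVecs (allF2^ k) d) (cong (_^ d) (length-allF2^ k))))

  sliceHits≤ : ∀ k d (V : F2^ (k ^ suc d) → Bool) x → sliceHits k d V x ≤ nonzeroHits k d (slice V x)
  sliceHits≤ k d V x with nonzeroᵇ x
  ... | true = ≤-refl
  ... | false = z≤n

  sliceHits-0v : ∀ k d (V : F2^ (k ^ suc d) → Bool) → sliceHits k d V 0v ≡ 0
  sliceHits-0v k d V rewrite nonzeroᵇ-0v {k} = refl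

  inAllSlices : ∀ {k n j} → (F2^ (k * n) → Bool) → Vec (F2^ k) j → Vec (F2^ n) j → Bool
  inAllSlices V [] [] = true
  inAllSlices {k} {n} V (y ∷ P) (w ∷ W) = slice {k} {n} V y w ∧ inAllSlices V P W

  count-inAllSlices : ∀ {k n j} (V : F2^ (k * n) → Bool) (P : Vec (F2^ k) j) →
    count (inAllSlices V P) (allVecs (allF2^ n) j) ≡ product (values (λ y → size (slice {k} {n} V y)) P)
  count-inAllSlices V [] = refl
  count-inAllSlices {k} {n} {suc j} V (y ∷ P) = begin
    count (inAllSlices V (y ∷ P)) (allVecs (allF2^ n) (suc j))
      ≡⟨ sumBy-allVecs-suc (allF2^ n) j _ ⟩
    sumBy (λ w → sumBy (λ W → 𝟙 (Vy w ∧ inAllSlices V P W)) Ws) (allF2^ n)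
      ≡⟨ sumBy-cong (allF2^ n) (λ w → sumBy-cong Ws (λ W → sym (𝟙-∧ (Vy w) _))) ⟩
    sumBy (λ w → sumBy (λ W → 𝟙 (Vy w) * 𝟙 (inAllSlices V P W)) Ws) (allF2^ n)
      ≡⟨ sumBy-cong (allF2^ n) (λ w → sumBy-*ˡ (𝟙 (Vy w)) _ Ws) ⟩
    sumBy (λ w → 𝟙 (Vy w) * rest) (allF2^ n)
      ≡⟨ sumBy-cong (allF2^ n) (λ w → *-comm (𝟙 (Vy w)) rest) ⟩
    sumBy (λ w → rest * 𝟙 (Vy w)) (allF2^ n)
      ≡⟨ sumBy-*ˡ rest (λ w → 𝟙 (Vy w)) (allF2^ n) ⟩
    rest * size Vy
      ≡⟨ *-comm rest (size Vy) ⟩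
    size Vy * rest
      ≡⟨ cong (size Vy *_) (count-inAllSlices V P) ⟩
    product (values (λ y → size (slice {k} {n} V y)) (y ∷ P)) ∎
    where
    open ≡-Reasoning
    Vy = slice {k} {n} V y
    Ws = allVecs (allF2^ n) j
    rest = count (inAllSlices V P) Ws

  Σ⊗-closed : ∀ {k n j} (V : F2^ (k * n) → Bool) → IsSubspace V → (P : Vec (F2^ k) j) (W : Vec (F2^ n) j) →
    inAllSlices V P W ≡ true → V (Σ⊗ P W) ≡ true
  Σ⊗-closed V (V∋0 , _) [] [] _ = V∋0
  Σ⊗-closed V V-sub@(_ , V-closed) (y ∷ P) (w ∷ W) in-slices with ∧-true {slice V y w} in-slices
  ... | in-y , in-rest = V-closed _ _ in-y (Σ⊗-closed V V-sub P W in-rest)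

  -- For independent P, W ↦ Σ⊗ P W embeds the product of the slices of V at P into V.
  product-slice-sizes≤size : ∀ {k n} (V : F2^ (k * n) → Bool) → IsSubspace V → (P : Vec (F2^ k) k) → Independent P →
    product (values (λ y → size (slice {k} {n} V y)) P) ≤ size V
  product-slice-sizes≤size {k} {n} V V-sub P independent = ≤-trans (≤-reflexive (sym (count-inAllSlices V P)))
    (count-injection _≟ᵛ_ (≡-dec _≟ᵛ_) (allF2^-enumerates (k * n)) (allVecs (allF2^ n) k)
      (λ W → ≤-reflexive (Multiplicity.mult≡1 (allVecs-enumerates _≟ᵛ_ (allF2^-enumerates n) k) W))
      (inAllSlices V P) V (Σ⊗ P) (Σ⊗-closed V V-sub P) (λ U W _ _ → Σ⊗-injective P independent U W))

  nonzeroHits-1≤size : ∀ k (V : F2^ (k ^ 1) → Bool) → nonzeroHits k 1 V ≤ size V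
  nonzeroHits-1≤size k V =
    count-injection _≟ᵛ_ (≡-dec _≟ᵛ_) (allF2^-enumerates (k * 1)) (allVecs (allF2^ k) 1)
      (λ xs → ≤-reflexive (Multiplicity.mult≡1 (allVecs-enumerates _≟ᵛ_ (allF2^-enumerates k) 1) xs))
      (λ xs → allNonzero xs ∧ V (⨂ xs)) V ⨂ (λ xs in-V → proj₂ (∧-true {allNonzero xs} in-V))
      (λ { (x ∷ []) (x′ ∷ []) _ _ eq → cong (_∷ []) (⊗[1]-injective x x′ eq) })

  -- The values g = sliceHits are clamped to h = L ⊔ g to lie in the range [L, 2^k L] demanded by
  -- dyadicSum-bound; this costs nothing since every slice has at least one element.
  module InductionStep {k e : ℕ}
    (ih : ∀ (W : F2^ (k ^ suc e) → Bool) → IsSubspace W → nonzeroHits k (suc e) W ^ (k ^ e) ≤ size W * 2 ^ (k * e * k ^ e))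
    (V : F2^ (k ^ suc (suc e)) → Bool) (V-sub : IsSubspace V) where

    open ≤-Reasoning
    n = k ^ suc e
    K = k ^ e
    L = 2 ^ (k * e)
    g : F2^ k → ℕ
    g = sliceHits k (suc e) V
    h : F2^ k → ℕ
    h y = L ⊔ g y
    sliceSize : F2^ k → ℕ
    sliceSize y = size (slice {k} {n} V y)
    P = GreedyBasis.basis k g k
    greedy : Independent P × sumBy g (allF2^ k) ≤ dyadicSum (values g P) × Linked _≤_ (values g P)
    greedy = GreedyBasis.greedy-basis k g (sliceHits-0v k (suc e) V)

    N≤dyadicSum : nonzeroHits k (suc (suc e)) V ≤ dyadicSum (values h P)
    N≤dyadicSum = begin
      nonzeroHits k (suc (suc e)) V ≡⟨ nonzeroHits-suc k (suc e) V ⟩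
      sumBy g (allF2^ k)              ≤⟨ proj₁ (proj₂ greedy) ⟩
      dyadicSum (values g P)          ≤⟨ dyadicSum-values-mono P (λ y → m≤n⊔m L (g y)) ⟩
      dyadicSum (values h P)          ∎

    h-in-range : ∀ y → InRange L (2 ^ k * L) (h y)
    h-in-range y = m≤m⊔n L (g y) , ⊔-lub (m≤n*m L (2 ^ k) {{m^n≢0 2 k}}) (begin
      g y                                   ≤⟨ sliceHits≤ k (suc e) V y ⟩
      nonzeroHits k (suc e) (slice V y)   ≤⟨ nonzeroHits≤ k (suc e) (slice V y) ⟩
      (2 ^ k) ^ suc e                       ≡⟨ cong (2 ^ k *_) (^-*-assoc 2 k e) ⟩
      2 ^ k * L                             ∎)

    dyadic-bound : dyadicSum (values h P) ^ k ≤ 2 ^ (k * k) * product (values h P)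
    dyadic-bound = dyadicSum-bound k L (m^n>0 2 (k * e)) (values h P) (length-toList (Data.Vec.map h P))
      (Linked-values-map g (L ⊔_) P (⊔-monoʳ-≤ L) (proj₂ (proj₂ greedy))) (All-values h P h-in-range)

    clamped-slice-bound : ∀ y → h y ^ K ≤ sliceSize y * L ^ K
    clamped-slice-bound y with ≤-total L (g y)
    ... | inj₁ L≤g rewrite m≤n⇒m⊔n≡n L≤g = begin
      g y ^ K                                       ≤⟨ ^-monoˡ-≤ K (sliceHits≤ k (suc e) V y) ⟩
      nonzeroHits k (suc e) (slice V y) ^ K       ≤⟨ ih (slice V y) (slice-subspace V V-sub y) ⟩
      sliceSize y * 2 ^ (k * e * K)    ≡⟨ cong (sliceSize y *_) (^-*-assoc 2 (k * e) K) ⟨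
      sliceSize y * L ^ K              ∎
    ... | inj₂ g≤L rewrite m≥n⇒m⊔n≡m g≤L = begin
      L ^ K                                         ≡⟨ *-identityˡ (L ^ K) ⟨
      1 * L ^ K                                     ≤⟨ *-monoˡ-≤ (L ^ K) (size-pos (slice V y) (slice-subspace V V-sub y)) ⟩
      sliceSize y * L ^ K              ∎

    product-bound : product (values h P) ^ K ≤ size V * (L ^ K) ^ k
    product-bound = begin
      product (values h P) ^ K                          ≡⟨ product-values-^ h P K ⟩
      product (values (λ y → h y ^ K) P)                ≤⟨ product-values-mono P clamped-slice-bound ⟩
      product (values (λ y → sliceSize y * L ^ K) P)    ≡⟨ product-values-*ʳ sliceSize (L ^ K) P ⟩
      product (values sliceSize P) * (L ^ K) ^ k        ≤⟨ *-monoˡ-≤ ((L ^ K) ^ k) (product-slice-sizes≤size V V-sub P (proj₁ greedy)) ⟩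
      size V * (L ^ K) ^ k                              ∎

    exponents : (2 ^ (k * k)) ^ K * (size V * (L ^ K) ^ k) ≡ size V * 2 ^ (k * suc e * (k * K))
    exponents = begin-equality
      (2 ^ (k * k)) ^ K * (S * (L ^ K) ^ k)
        ≡⟨ cong₂ (λ a b → a * (S * b)) (^-*-assoc 2 (k * k) K) (trans (^-*-assoc L K k) (^-*-assoc 2 (k * e) (K * k))) ⟩
      2 ^ (k * k * K) * (S * 2 ^ (k * e * (K * k)))   ≡⟨ swap (2 ^ (k * k * K)) S (2 ^ (k * e * (K * k))) ⟩
      S * (2 ^ (k * k * K) * 2 ^ (k * e * (K * k)))   ≡⟨ cong (S *_) (^-distribˡ-+-* 2 (k * k * K) _) ⟨
      S * 2 ^ (k * k * K + k * e * (K * k))           ≡⟨ cong (λ i → S * 2 ^ i) (sum-exponents k e K) ⟩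
      S * 2 ^ (k * suc e * (k * K))                   ∎
      where
      S = size V
      swap : ∀ a b c → a * (b * c) ≡ b * (a * c)
      swap = solve-∀
      sum-exponents : ∀ k e K → k * k * K + k * e * (K * k) ≡ k * suc e * (k * K)
      sum-exponents = solve-∀

    bound : nonzeroHits k (suc (suc e)) V ^ (k * K) ≤ size V * 2 ^ (k * suc e * (k * K))
    bound = begin
      N ^ (k * K)                                              ≡⟨ ^-*-assoc N k K ⟨
      (N ^ k) ^ K                                              ≤⟨ ^-monoˡ-≤ K (^-monoˡ-≤ k N≤dyadicSum) ⟩
      (dyadicSum (values h P) ^ k) ^ K                         ≤⟨ ^-monoˡ-≤ K dyadic-bound ⟩
      (2 ^ (k * k) * product (values h P)) ^ K                 ≡⟨ *-^-distrib (2 ^ (k * k)) _ K ⟩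
      (2 ^ (k * k)) ^ K * product (values h P) ^ K             ≤⟨ *-monoʳ-≤ ((2 ^ (k * k)) ^ K) product-bound ⟩
      (2 ^ (k * k)) ^ K * (size V * (L ^ K) ^ k)               ≡⟨ exponents ⟩
      size V * 2 ^ (k * suc e * (k * K))                       ∎
      where N = nonzeroHits k (suc (suc e)) V

  nonzeroHits-bound : ∀ k e (V : F2^ (k ^ suc e) → Bool) → IsSubspace V →
    nonzeroHits k (suc e) V ^ (k ^ e) ≤ size V * 2 ^ (k * e * k ^ e)
  nonzeroHits-bound k zero V _ = begin
    nonzeroHits k 1 V ^ 1     ≡⟨ *-identityʳ _ ⟩
    nonzeroHits k 1 V         ≤⟨ nonzeroHits-1≤size k V ⟩
    size V                      ≡⟨ *-identityʳ _ ⟨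
    size V * 1                  ≡⟨ cong (λ i → size V * 2 ^ (i * 1)) (*-zeroʳ k) ⟨
    size V * 2 ^ (k * 0 * 1)    ∎
    where open ≤-Reasoning
  nonzeroHits-bound k (suc e) V V-sub = InductionStep.bound {k} {e} (nonzeroHits-bound k e) V V-sub

module Flattening where

  open import Data.Nat hiding (_≟_)
  open import Data.Bool using (Bool; true; false; _∧_; _xor_; not)
  open import Data.Bool.Properties using (not-involutive)
  open import Data.Fin using (Fin; zero; suc)
  open import Data.List.Membership.Propositional.Properties using (∈-allFin)
  open import Data.Vec using (Vec; []; _∷_; _++_; lookup; map)
  open import Relation.Binary.PropositionalEquality
  open import Defs using (F2^; Tensor; tensorProd; lincomb; isZero; Sample; tensors)
  open Counting
  open F2Vectors
  open TensorProduct

  flatRows : ∀ {k m} → (Fin k → F2^ m) → F2^ (k * m)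
  flatRows {zero} f = []
  flatRows {suc k} f = f zero ++ flatRows (λ i → f (suc i))

  flatten : ∀ {k d} → Tensor k d → F2^ (k ^ d)
  flatten {k} {zero} T = T [] ∷ []
  flatten {k} {suc d} T = flatRows (λ i → flatten (λ ι → T (i ∷ ι)))

  flatRows-cong : ∀ {k m} {f g : Fin k → F2^ m} → (∀ i → f i ≡ g i) → flatRows f ≡ flatRows g
  flatRows-cong {zero} f≡g = refl
  flatRows-cong {suc k} f≡g = cong₂ _++_ (f≡g zero) (flatRows-cong (λ i → f≡g (suc i)))

  flatten-cong : ∀ {k d} {T T′ : Tensor k d} → (∀ ι → T ι ≡ T′ ι) → flatten T ≡ flatten T′
  flatten-cong {k} {zero} T≡T′ = cong (_∷ []) (T≡T′ [])
  flatten-cong {k} {suc d} T≡T′ = flatRows-cong (λ i → flatten-cong (λ ι → T≡T′ (i ∷ ι)))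

  flatRows-0v : ∀ {k m} → flatRows {k} {m} (λ _ → 0v) ≡ 0v
  flatRows-0v {zero} = refl
  flatRows-0v {suc k} {m} = trans (cong (0v ++_) (flatRows-0v {k})) (sym (0v-++ m (k * m)))

  flatten-false : ∀ {k d} → flatten {k} {d} (λ _ → false) ≡ 0v
  flatten-false {k} {zero} = refl
  flatten-false {k} {suc d} = trans (flatRows-cong {k} (λ i → flatten-false {k} {d})) (flatRows-0v {k} {k ^ d})

  flatRows-⊕ : ∀ {k m} (f g : Fin k → F2^ m) → flatRows (λ i → f i ⊕ g i) ≡ flatRows f ⊕ flatRows g
  flatRows-⊕ {zero} f g = refl
  flatRows-⊕ {suc k} f g = trans (cong (f zero ⊕ g zero ++_) (flatRows-⊕ (λ i → f (suc i)) (λ i → g (suc i))))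
    (sym (⊕-++ (f zero) (g zero) (flatRows (λ i → f (suc i))) (flatRows (λ i → g (suc i)))))

  flatten-xor : ∀ {k d} (A B : Tensor k d) → flatten (λ ι → A ι xor B ι) ≡ flatten A ⊕ flatten B
  flatten-xor {k} {zero} A B = refl
  flatten-xor {k} {suc d} A B = trans (flatRows-cong {k} (λ i → flatten-xor (λ ι → A (i ∷ ι)) (λ ι → B (i ∷ ι))))
    (flatRows-⊕ {k} (λ i → flatten (λ ι → A (i ∷ ι))) (λ i → flatten (λ ι → B (i ∷ ι))))

  flatten-∧ : ∀ {k d} b (T : Tensor k d) → flatten (λ ι → b ∧ T ι) ≡ b · flatten T
  flatten-∧ true T = refl
  flatten-∧ {k} {d} false T = flatten-false {k} {d}

  flatRows-· : ∀ {k m} (u : F2^ k) (w : F2^ m) → flatRows (λ i → lookup u i · w) ≡ u ⊗ w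
  flatRows-· [] w = refl
  flatRows-· (b ∷ u) w = cong (b · w ++_) (flatRows-· u w)

  flatten-tensorProd : ∀ {k d} (xs : Vec (F2^ k) d) → flatten (tensorProd xs) ≡ ⨂ xs
  flatten-tensorProd [] = refl
  flatten-tensorProd (u ∷ us) = trans
    (flatRows-cong (λ i → trans (flatten-∧ (lookup u i) (tensorProd us)) (cong (lookup u i ·_) (flatten-tensorProd us))))
    (flatRows-· u (⨂ us))

  flatten-lincomb : ∀ {k d t} (c : Vec Bool t) (Ts : Vec (Tensor k d) t) → flatten (lincomb c Ts) ≡ linComb c (map flatten Ts)
  flatten-lincomb {k} {d} [] [] = flatten-false {k} {d}
  flatten-lincomb (c ∷ cs) (T ∷ Ts) =
    trans (flatten-xor (λ ι → c ∧ T ι) (lincomb cs Ts)) (cong₂ _⊕_ (flatten-∧ c T) (flatten-lincomb cs Ts))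

  flatten-tensors : ∀ {d k t} (X : Sample d k t) → map flatten (tensors X) ≡ map ⨂ X
  flatten-tensors [] = refl
  flatten-tensors (x ∷ X) = cong₂ _∷_ (flatten-tensorProd x) (flatten-tensors X)

  isZero⇒flatten≡0v : ∀ {k d} (T : Tensor k d) → isZero T ≡ true → flatten T ≡ 0v
  isZero⇒flatten≡0v {k} {d} T zero-T = trans (flatten-cong {T′ = λ _ → false} T≡false) (flatten-false {k} {d})
    where
    T≡false : ∀ ι → T ι ≡ false
    T≡false ι = trans (sym (not-involutive (T ι)))
      (cong not (allᵇ-elim (λ ι → not (T ι)) zero-T (∈-allVecs ∈-allFin ι)))

module SpanningSubset where

  open import Data.Nat hiding (_≟_)
  open import Data.Nat.Properties hiding (_≟_)
  open import Data.Bool using (Bool; true; false; _∧_; _∨_; not; _xor_; if_then_else_)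
  open import Data.Bool.ListAction using (any)
  open import Data.Bool.Properties using (xor-identityʳ; not-involutive)
  open import Data.Fin using (Fin; zero; suc)
  open import Data.List using ([]; _∷_; map; foldr)
  open import Data.List.Membership.Propositional using (_∈_)
  open import Data.List.Relation.Unary.Any using (here; there)
  open import Data.Vec using (Vec; []; _∷_; lookup)
  import Data.Vec as Vec
  open import Data.Product using (_×_; _,_; proj₂; ∃)
  open import Data.Sum using (_⊎_; inj₁; inj₂)
  open import Data.Empty using (⊥-elim)
  open import Relation.Binary.PropositionalEquality
  open import Defs using (F2^; Tensor; lincomb; isZero; subsetᵇ; nonzeroᵇ; card; independentᵇ; dimSpan)
  open Counting
  open F2Vectors
  open Flattening
  private module M {n} = MultF2 {n}

  inSubspan : ∀ {t n} → F2^ t → Vec (F2^ n) t → F2^ n → Bool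
  inSubspan {t} S G w = any (λ c → subsetᵇ c S ∧ (linComb c G ==ᵛ w)) (allF2^ t)

  unit : ∀ {t} → Fin t → F2^ t
  unit zero = true ∷ 0v
  unit (suc i) = false ∷ unit i

  card-⊕-unit : ∀ {t} (S : F2^ t) i → lookup S i ≡ false → card (S ⊕ unit i) ≡ suc (card S)
  card-⊕-unit (false ∷ S) zero _ rewrite ⊕-identityʳ S = refl
  card-⊕-unit (s ∷ S) (suc i) i∉S rewrite card-⊕-unit S i i∉S with s
  ... | true = refl
  ... | false = refl

  subsetᵇ-⊕-unit-∉ : ∀ {t} (c S : F2^ t) i → subsetᵇ c (S ⊕ unit i) ≡ true → lookup c i ≡ false → subsetᵇ c S ≡ true
  subsetᵇ-⊕-unit-∉ (false ∷ c) (s ∷ S) zero c⊆ _ rewrite ⊕-identityʳ S = proj₂ (∧-true {not false ∨ (s xor true)} c⊆)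
  subsetᵇ-⊕-unit-∉ (a ∷ c) (s ∷ S) (suc i) c⊆ i∉c rewrite xor-identityʳ s with ∧-true {not a ∨ s} c⊆
  ... | head⊆ , tail⊆ rewrite head⊆ = subsetᵇ-⊕-unit-∉ c S i tail⊆ i∉c

  subsetᵇ-⊕-unit-∈ : ∀ {t} (c S : F2^ t) i → subsetᵇ c (S ⊕ unit i) ≡ true → lookup c i ≡ true → subsetᵇ (c ⊕ unit i) S ≡ true
  subsetᵇ-⊕-unit-∈ (true ∷ c) (s ∷ S) zero c⊆ _ rewrite ⊕-identityʳ S | ⊕-identityʳ c = proj₂ (∧-true {not true ∨ (s xor true)} c⊆)
  subsetᵇ-⊕-unit-∈ (a ∷ c) (s ∷ S) (suc i) c⊆ i∈c rewrite xor-identityʳ s | xor-identityʳ a with ∧-true {not a ∨ s} c⊆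
  ... | head⊆ , tail⊆ rewrite head⊆ = subsetᵇ-⊕-unit-∈ c S i tail⊆ i∈c

  linComb-unit : ∀ {t n} (i : Fin t) (G : Vec (F2^ n) t) → linComb (unit i) G ≡ lookup G i
  linComb-unit zero (g ∷ G) = trans (cong (g ⊕_) (linComb-0v G)) (⊕-identityʳ g)
  linComb-unit (suc i) (g ∷ G) = trans (⊕-identityˡ _) (linComb-unit i G)

  nonempty-subset-of-0v : ∀ {t} (c : F2^ t) → (subsetᵇ c 0v ∧ nonzeroᵇ c) ≡ false
  nonempty-subset-of-0v c with subsetᵇ c 0v in c⊆∅
  ... | false = refl
  ... | true = only-0v c c⊆∅
    where
    only-0v : ∀ {t} (c : F2^ t) → subsetᵇ c 0v ≡ true → nonzeroᵇ c ≡ false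
    only-0v [] _ = refl
    only-0v (false ∷ c) c⊆∅ = only-0v c c⊆∅

  card-0v : ∀ {t} → card (0v {t}) ≡ 0
  card-0v {zero} = refl
  card-0v {suc t} = card-0v {t}

  module _ {k d t : ℕ} (Ts : Vec (Tensor k d) t) where

    independentᵇ-elim : ∀ S c → independentᵇ Ts S ≡ true → (subsetᵇ c S ∧ nonzeroᵇ c) ≡ true → isZero (lincomb c Ts) ≡ false
    independentᵇ-elim S c indep c-nonempty with allᵇ-elim _ indep (M.Enumerates⇒∈ (allF2^-enumerates t) c)
    ... | c-not-zero rewrite c-nonempty = trans (sym (not-involutive _)) (cong not c-not-zero)

    dependentᵇ-elim : ∀ S → independentᵇ Ts S ≡ false →
      ∃ λ c → (subsetᵇ c S ∧ nonzeroᵇ c) ≡ true × isZero (lincomb c Ts) ≡ true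
    dependentᵇ-elim S dep with allᵇ-false _ (allF2^ t) dep
    ... | c , _ with subsetᵇ c S ∧ nonzeroᵇ c in c-nonempty | isZero (lincomb c Ts) in c-zero
    ... | true | true = c , c-nonempty , c-zero

    independentᵇ-0v : independentᵇ Ts 0v ≡ true
    independentᵇ-0v = allᵇ-intro _ (allF2^ t) (λ c → cong (λ b → not b ∨ not (isZero (lincomb c Ts))) (nonempty-subset-of-0v c))

  module _ {A : Set} (h : A → ℕ) where

    ⊔-attained : ∀ xs r → foldr _⊔_ 0 (map h xs) ≡ r → r ≡ 0 ⊎ ∃ λ x → h x ≡ r
    ⊔-attained [] r max≡r = inj₁ (sym max≡r)
    ⊔-attained (x ∷ xs) r max≡r with ⊔-sel (h x) (foldr _⊔_ 0 (map h xs))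
    ... | inj₁ by-x = inj₂ (x , trans (sym by-x) max≡r)
    ... | inj₂ by-rest = ⊔-attained xs r (trans (sym by-rest) max≡r)

    ⊔-upper : ∀ {x xs} → x ∈ xs → h x ≤ foldr _⊔_ 0 (map h xs)
    ⊔-upper (here refl) = m≤m⊔n _ _
    ⊔-upper (there x∈xs) = ≤-trans (⊔-upper x∈xs) (m≤n⊔m _ _)

  module _ {k d t : ℕ} (Ts : Vec (Tensor k d) t) where

    private
      size-if-independent : F2^ t → ℕ
      size-if-independent S = if independentᵇ Ts S then card S else 0

    dimSpan-attained : ∀ r → dimSpan Ts ≡ r → ∃ λ S → independentᵇ Ts S ≡ true × card S ≡ r
    dimSpan-attained zero _ = 0v , independentᵇ-0v Ts , card-0v {t}
    dimSpan-attained (suc r) dim≡ with ⊔-attained size-if-independent (allF2^ t) (suc r) dim≡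
    ... | inj₂ (S , size≡) with independentᵇ Ts S in indep
    ...   | true = S , indep , size≡

    -- A maximum-size independent S spans: adding any i ∉ S creates a dependency, which must involve i.
    dimSpan-spanning-subset : ∀ r → dimSpan Ts ≡ r →
      ∃ λ S → card S ≡ r × (∀ i → lookup S i ≡ false → inSubspan S (Vec.map flatten Ts) (lookup (Vec.map flatten Ts) i) ≡ true)
    dimSpan-spanning-subset r dim≡ with dimSpan-attained r dim≡
    ... | S , indep , card≡ = S , card≡ , spans
      where
      spans : ∀ i → lookup S i ≡ false → inSubspan S (Vec.map flatten Ts) (lookup (Vec.map flatten Ts) i) ≡ true
      spans i i∉S with independentᵇ Ts (S ⊕ unit i) in indep′
      ... | true = ⊥-elim (<⇒≱ (s≤s ≤-refl) (subst₂ _≤_ larger dim≡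
                     (⊔-upper size-if-independent (M.Enumerates⇒∈ (allF2^-enumerates t) (S ⊕ unit i)))))
        where
        larger : size-if-independent (S ⊕ unit i) ≡ suc r
        larger = trans (cong (λ b → if b then card (S ⊕ unit i) else 0) indep′) (trans (card-⊕-unit S i i∉S) (cong suc card≡))
      ... | false with dependentᵇ-elim Ts (S ⊕ unit i) indep′
      ...   | c , c-nonempty , c-zero with ∧-true {subsetᵇ c (S ⊕ unit i)} c-nonempty | lookup c i in c-at-i
      ...     | c⊆ , c≢0 | false = true≢false c-zero (independentᵇ-elim Ts S c indep (cong₂ _∧_ (subsetᵇ-⊕-unit-∉ c S i c⊆ c-at-i) c≢0))
      ...     | c⊆ , c≢0 | true = any-intro _ (M.Enumerates⇒∈ (allF2^-enumerates t) (c ⊕ unit i))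
                  (cong₂ _∧_ (subsetᵇ-⊕-unit-∈ c S i c⊆ c-at-i) (M.==-complete combination))
        where
        open ≡-Reasoning
        FT = Vec.map flatten Ts
        combination : linComb (c ⊕ unit i) FT ≡ lookup FT i
        combination = begin
          linComb (c ⊕ unit i) FT            ≡⟨ linComb-⊕ c (unit i) FT ⟩
          linComb c FT ⊕ linComb (unit i) FT ≡⟨ cong₂ _⊕_ c-gives-0v (linComb-unit i FT) ⟩
          0v ⊕ lookup FT i                   ≡⟨ ⊕-identityˡ _ ⟩
          lookup FT i                        ∎
          where
          c-gives-0v : linComb c FT ≡ 0v
          c-gives-0v = trans (sym (flatten-lincomb c Ts)) (isZero⇒flatten≡0v (lincomb c Ts) c-zero)

module CountingOutsideS where

  open import Data.Nat hiding (_≟_)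
  open import Data.Nat.Properties hiding (_≟_)
  open import Data.Nat.Tactic.RingSolver using (solve-∀)
  open import Data.Bool using (Bool; true; false; _∧_; not; _∨_)
  open import Data.Bool.Properties using (∧-identityʳ; ∧-zeroʳ)
  open import Data.Fin using (zero; suc)
  open import Data.List using (List; []; _∷_; length)
  open import Data.Vec using (Vec; []; _∷_; lookup; map)
  open import Data.Product using (_×_; _,_; proj₂)
  open import Data.Unit using (⊤; tt)
  open import Relation.Binary.PropositionalEquality
  open import Defs using (F2^; allVecs; card; subsetᵇ)
  open Counting
  open F2Vectors

  card≤ : ∀ {t} (S : F2^ t) → card S ≤ t
  card≤ [] = z≤n
  card≤ (true ∷ S) = s≤s (card≤ S)
  card≤ (false ∷ S) = m≤n⇒m≤1+n (card≤ S)

  module _ {R : Set} where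

    allOutside : ∀ {t} → F2^ t → (R → Bool) → Vec R t → Bool
    allOutside [] p [] = true
    allOutside (true ∷ S) p (x ∷ X) = allOutside S p X
    allOutside (false ∷ S) p (x ∷ X) = p x ∧ allOutside S p X

    allOutside-intro : ∀ {t} (S : F2^ t) (p : R → Bool) X → (∀ i → lookup S i ≡ false → p (lookup X i) ≡ true) → allOutside S p X ≡ true
    allOutside-intro [] p [] _ = refl
    allOutside-intro (true ∷ S) p (x ∷ X) outside = allOutside-intro S p X (λ i → outside (suc i))
    allOutside-intro (false ∷ S) p (x ∷ X) outside rewrite outside zero refl = allOutside-intro S p X (λ i → outside (suc i))

    AgreeOn : ∀ {t} → F2^ t → Vec R t → Vec R t → Set
    AgreeOn [] [] [] = ⊤
    AgreeOn (true ∷ S) (x ∷ X) (y ∷ Y) = x ≡ y × AgreeOn S X Y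
    AgreeOn (false ∷ S) (x ∷ X) (y ∷ Y) = AgreeOn S X Y

    AgreeOn-refl : ∀ {t} (S : F2^ t) X → AgreeOn S X X
    AgreeOn-refl [] [] = tt
    AgreeOn-refl (true ∷ S) (x ∷ X) = refl , AgreeOn-refl S X
    AgreeOn-refl (false ∷ S) (x ∷ X) = AgreeOn-refl S X

    DependsOnlyOn : ∀ {t} {K : Set} → F2^ t → (Vec R t → K) → Set
    DependsOnlyOn S key = ∀ X Y → AgreeOn S X Y → key X ≡ key Y

    -- Coordinates in S are free (|Rs| choices each); every other coordinate must satisfy a test fixed by the
    -- S-coordinates, which passes at most M times.
    count-allOutside≤ : ∀ (Rs : List R) (x₀ : R) (M : ℕ) {t} (S : F2^ t) {K : Set} (key : Vec R t → K) → DependsOnlyOn S key →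
      (test : K → R → Bool) → (∀ κ → count (test κ) Rs ≤ M) →
      count (λ X → allOutside S (test (key X)) X) (allVecs Rs t) ≤ length Rs ^ card S * M ^ (t ∸ card S)
    count-allOutside≤ Rs x₀ M [] key _ test _ = s≤s z≤n
    count-allOutside≤ Rs x₀ M {suc t} (true ∷ S) key depends test ≤M = begin
      count (λ X → allOutside (true ∷ S) (test (key X)) X) (allVecs Rs (suc t))
        ≡⟨ sumBy-allVecs-suc Rs t _ ⟩
      sumBy (λ x → count (λ X → allOutside S (test (key (x ∷ X))) X) (allVecs Rs t)) Rs
        ≤⟨ sumBy-mono Rs (λ x → count-allOutside≤ Rs x₀ M S (λ X → key (x ∷ X))
             (λ X Y agree → depends (x ∷ X) (x ∷ Y) (refl , agree)) test ≤M) ⟩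
      sumBy (λ x → length Rs ^ card S * M ^ (t ∸ card S)) Rs
        ≡⟨ sumBy-const _ Rs ⟩
      length Rs ^ card S * M ^ (t ∸ card S) * length Rs
        ≡⟨ rearrange (length Rs ^ card S) (M ^ (t ∸ card S)) (length Rs) ⟩
      length Rs ^ suc (card S) * M ^ (t ∸ card S) ∎
      where
      open ≤-Reasoning
      rearrange : ∀ a b c → a * b * c ≡ c * a * b
      rearrange = solve-∀
    count-allOutside≤ Rs x₀ M {suc t} (false ∷ S) {K} key depends test ≤M = begin
      count (λ X → allOutside (false ∷ S) (test (key X)) X) (allVecs Rs (suc t))
        ≡⟨ sumBy-allVecs-suc Rs t _ ⟩
      sumBy (λ x → sumBy (λ X → 𝟙 (test (key (x ∷ X)) x ∧ allOutside S (test (key (x ∷ X))) X)) (allVecs Rs t)) Rs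
        ≡⟨ sumBy-cong Rs (λ x → sumBy-cong (allVecs Rs t) (λ X →
             cong (λ κ → 𝟙 (test κ x ∧ allOutside S (test κ) X)) (depends (x ∷ X) (x₀ ∷ X) (AgreeOn-refl S X)))) ⟩
      sumBy (λ x → sumBy (λ X → 𝟙 (test (key₀ X) x ∧ rest X)) (allVecs Rs t)) Rs
        ≡⟨ sumBy-swap _ Rs (allVecs Rs t) ⟩
      sumBy (λ X → sumBy (λ x → 𝟙 (test (key₀ X) x ∧ rest X)) Rs) (allVecs Rs t)
        ≤⟨ sumBy-mono (allVecs Rs t) first≤ ⟩
      sumBy (λ X → M * 𝟙 (rest X)) (allVecs Rs t)
        ≡⟨ sumBy-*ˡ M _ (allVecs Rs t) ⟩
      M * count rest (allVecs Rs t)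
        ≤⟨ *-monoʳ-≤ M (count-allOutside≤ Rs x₀ M S key₀ (λ X Y agree → depends (x₀ ∷ X) (x₀ ∷ Y) agree) test ≤M) ⟩
      M * (length Rs ^ card S * M ^ (t ∸ card S))
        ≡⟨ rearrange M (length Rs ^ card S) (M ^ (t ∸ card S)) ⟩
      length Rs ^ card S * M ^ suc (t ∸ card S)
        ≡⟨ cong (λ i → length Rs ^ card S * M ^ i) (+-∸-assoc 1 (card≤ S)) ⟨
      length Rs ^ card S * M ^ (suc t ∸ card S) ∎
      where
      open ≤-Reasoning
      key₀ : Vec R t → K
      key₀ X = key (x₀ ∷ X)
      rest : Vec R t → Bool
      rest X = allOutside S (test (key₀ X)) X
      rearrange : ∀ a b c → a * (b * c) ≡ b * (a * c)
      rearrange = solve-∀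
      first≤ : ∀ X → sumBy (λ x → 𝟙 (test (key₀ X) x ∧ rest X)) Rs ≤ M * 𝟙 (rest X)
      first≤ X with rest X
      ... | true = ≤-trans (≤-reflexive (sumBy-cong Rs (λ x → cong 𝟙 (∧-identityʳ _))))
                     (≤-trans (≤M (key₀ X)) (≤-reflexive (sym (*-identityʳ M))))
      ... | false = ≤-trans (≤-reflexive (trans (sumBy-cong Rs (λ x → cong 𝟙 (∧-zeroʳ _))) (sumBy-zero Rs))) z≤n

    mask : ∀ {t} → F2^ t → R → Vec R t → Vec R t
    mask [] x₀ [] = []
    mask (true ∷ S) x₀ (x ∷ X) = x ∷ mask S x₀ X
    mask (false ∷ S) x₀ (x ∷ X) = x₀ ∷ mask S x₀ X

    mask-dependsOnlyOn : ∀ {t} (S : F2^ t) x₀ → DependsOnlyOn S (mask S x₀)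
    mask-dependsOnlyOn [] x₀ [] [] _ = refl
    mask-dependsOnlyOn (true ∷ S) x₀ (x ∷ X) (y ∷ Y) (x≡y , agree) = cong₂ _∷_ x≡y (mask-dependsOnlyOn S x₀ X Y agree)
    mask-dependsOnlyOn (false ∷ S) x₀ (x ∷ X) (y ∷ Y) agree = cong (x₀ ∷_) (mask-dependsOnlyOn S x₀ X Y agree)

    linComb-mask : ∀ {t n} (φ : R → F2^ n) (S : F2^ t) x₀ X c → subsetᵇ c S ≡ true →
      linComb c (map φ X) ≡ linComb c (map φ (mask S x₀ X))
    linComb-mask φ [] x₀ [] [] _ = refl
    linComb-mask φ (true ∷ S) x₀ (x ∷ X) (a ∷ c) c⊆S = cong (a · φ x ⊕_) (linComb-mask φ S x₀ X c (proj₂ (∧-true {not a ∨ true} c⊆S)))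
    linComb-mask φ (false ∷ S) x₀ (x ∷ X) (false ∷ c) c⊆S = cong (0v ⊕_) (linComb-mask φ S x₀ X c c⊆S)

module HitsInSpan where

  open import Data.Nat hiding (_≟_)
  open import Data.Nat.Properties hiding (_≟_)
  open import Data.Nat.Tactic.RingSolver using (solve-∀)
  open import Data.Bool using (Bool; true; false; _∧_; _∨_; not; _xor_)
  open import Data.Bool.ListAction using (any)
  open import Data.Bool.Properties using (not-involutive)
  open import Data.List using ([]; _∷_; length)
  open import Data.Vec using (Vec; []; _∷_; map)
  open import Data.Product using (_,_)
  open import Data.Sum using (inj₁; inj₂)
  open import Data.Empty using (⊥-elim)
  open import Function using (_∘_)
  open import Relation.Nullary using (yes; no)
  open import Relation.Binary.PropositionalEquality
  open import Defs using (F2^; allVecs; subsetᵇ; nonzeroᵇ)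
  open Counting
  open F2Vectors
  open TensorProduct
  open ProductsInSubspaces
  open SpanningSubset
  open CountingOutsideS
  private module M {n} = MultF2 {n}

  inSubspan-mask : ∀ {R : Set} {t n} (φ : R → F2^ n) (S : F2^ t) x₀ X w →
    inSubspan S (map φ X) w ≡ inSubspan S (map φ (mask S x₀ X)) w
  inSubspan-mask {t = t} φ S x₀ X w = any-cong (allF2^ t) same
    where
    same : ∀ c → (subsetᵇ c S ∧ (linComb c (map φ X) ==ᵛ w)) ≡ (subsetᵇ c S ∧ (linComb c (map φ (mask S x₀ X)) ==ᵛ w))
    same c with subsetᵇ c S in c⊆S
    ... | true rewrite linComb-mask φ S x₀ X c c⊆S = refl
    ... | false = refl

  subsetᵇ-⊕ : ∀ {t} (c c′ S : F2^ t) → subsetᵇ c S ≡ true → subsetᵇ c′ S ≡ true → subsetᵇ (c ⊕ c′) S ≡ true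
  subsetᵇ-⊕ [] [] [] _ _ = refl
  subsetᵇ-⊕ (a ∷ c) (a′ ∷ c′) (s ∷ S) c⊆S c′⊆S with ∧-true {not a ∨ s} c⊆S | ∧-true {not a′ ∨ s} c′⊆S
  ... | a⊆ , rest⊆ | a′⊆ , rest′⊆ rewrite subsetᵇ-⊕ c c′ S rest⊆ rest′⊆ = head⊆ a a′ s a⊆ a′⊆
    where
    head⊆ : ∀ a a′ s → (not a ∨ s) ≡ true → (not a′ ∨ s) ≡ true → ((not (a xor a′) ∨ s) ∧ true) ≡ true
    head⊆ true true true _ _ = refl
    head⊆ true false true _ _ = refl
    head⊆ false true true _ _ = refl
    head⊆ false false true _ _ = refl
    head⊆ false false false _ _ = refl

  subsetᵇ-0v : ∀ {t} (S : F2^ t) → subsetᵇ 0v S ≡ true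
  subsetᵇ-0v [] = refl
  subsetᵇ-0v (s ∷ S) = subsetᵇ-0v S

  inSubspan-subspace : ∀ {t n} (S : F2^ t) (G : Vec (F2^ n) t) → IsSubspace (inSubspan S G)
  inSubspan-subspace {t} {n} S G = contains-0v , closed
    where
    contains-0v : inSubspan S G 0v ≡ true
    contains-0v = any-intro _ (M.Enumerates⇒∈ (allF2^-enumerates t) 0v) (cong₂ _∧_ (subsetᵇ-0v S) (M.==-complete (linComb-0v G)))
    closed : ∀ a b → inSubspan S G a ≡ true → inSubspan S G b ≡ true → inSubspan S G (a ⊕ b) ≡ true
    closed a b a∈ b∈ with any-elim _ (allF2^ t) a∈ | any-elim _ (allF2^ t) b∈
    ... | c , c-gives | c′ , c′-gives with ∧-true {subsetᵇ c S} c-gives | ∧-true {subsetᵇ c′ S} c′-gives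
    ...   | c⊆S , c≡a | c′⊆S , c′≡b = any-intro _ (M.Enumerates⇒∈ (allF2^-enumerates t) (c ⊕ c′))
            (cong₂ _∧_ (subsetᵇ-⊕ c c′ S c⊆S c′⊆S)
              (M.==-complete (trans (linComb-⊕ c c′ G) (cong₂ _⊕_ (M.==-sound c≡a) (M.==-sound c′≡b)))))

  size-inSubspan≤ : ∀ {t n} (S : F2^ t) (G : Vec (F2^ n) t) → size (inSubspan S G) ≤ 2 ^ t
  size-inSubspan≤ {t} {n} S G = begin
    count (inSubspan S G) (allF2^ n)                                    ≤⟨ sumBy-mono (allF2^ n) (λ w → drop-subset (allF2^ t) w) ⟩
    count (λ w → any (λ c → linComb c G ==ᵛ w) (allF2^ t)) (allF2^ n)  ≤⟨ M.count-image≤ (allF2^-enumerates n) (λ c → linComb c G) (allF2^ t) ⟩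
    length (allF2^ t)                                                  ≡⟨ length-allF2^ t ⟩
    2 ^ t                                                              ∎
    where
    open ≤-Reasoning
    drop-subset : ∀ cs w → 𝟙 (any (λ c → subsetᵇ c S ∧ (linComb c G ==ᵛ w)) cs) ≤ 𝟙 (any (λ c → linComb c G ==ᵛ w) cs)
    drop-subset [] w = z≤n
    drop-subset (c ∷ cs) w with subsetᵇ c S | linComb c G ==ᵛ w
    ... | true | true = ≤-refl
    ... | false | true = 𝟙≤1 _
    ... | true | false = drop-subset cs w
    ... | false | false = drop-subset cs w

  withZeroFactor : ∀ k d → ℕ
  withZeroFactor k d = count (not ∘ allNonzero) (allVecs (allF2^ k) d)

  hits≤withZeroFactor+nonzeroHits : ∀ k d (V : F2^ (k ^ d) → Bool) →
    count (λ xs → V (⨂ xs)) (allVecs (allF2^ k) d) ≤ withZeroFactor k d + nonzeroHits k d V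
  hits≤withZeroFactor+nonzeroHits k d V = ≤-trans (sumBy-mono (allVecs (allF2^ k) d) split) (≤-reflexive (sumBy-+ _ _ (allVecs (allF2^ k) d)))
    where
    split : ∀ xs → 𝟙 (V (⨂ xs)) ≤ 𝟙 (not (allNonzero xs)) + 𝟙 (allNonzero xs ∧ V (⨂ xs))
    split xs with allNonzero xs
    ... | true = ≤-refl
    ... | false = ≤-trans (𝟙≤1 _) (m≤m+n 1 _)

  withZeroFactor-suc : ∀ k e → withZeroFactor k (suc e) ≤ (2 ^ k) ^ e + 2 ^ k * withZeroFactor k e
  withZeroFactor-suc k e = begin
    withZeroFactor k (suc e)
      ≡⟨ sumBy-allVecs-suc (allF2^ k) e _ ⟩
    sumBy (λ x → sumBy (λ xs → 𝟙 (not (nonzeroᵇ x ∧ allNonzero xs))) Xs) (allF2^ k)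
      ≤⟨ sumBy-mono (allF2^ k) (λ x → sumBy-mono Xs (λ xs → 𝟙-not-∧ (nonzeroᵇ x) (allNonzero xs))) ⟩
    sumBy (λ x → sumBy (λ xs → 𝟙 (not (nonzeroᵇ x)) + 𝟙 (not (allNonzero xs))) Xs) (allF2^ k)
      ≡⟨ sumBy-cong (allF2^ k) (λ x → sumBy-+ _ _ Xs) ⟩
    sumBy (λ x → sumBy (λ _ → 𝟙 (not (nonzeroᵇ x))) Xs + withZeroFactor k e) (allF2^ k)
      ≡⟨ sumBy-+ _ _ (allF2^ k) ⟩
    sumBy (λ x → sumBy (λ _ → 𝟙 (not (nonzeroᵇ x))) Xs) (allF2^ k) + sumBy (λ _ → withZeroFactor k e) (allF2^ k)
      ≡⟨ cong₂ _+_ (sumBy-cong (allF2^ k) (λ x → trans (sumBy-const _ Xs) (*-comm _ (length Xs)))) (sumBy-const _ (allF2^ k)) ⟩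
    sumBy (λ x → length Xs * 𝟙 (not (nonzeroᵇ x))) (allF2^ k) + withZeroFactor k e * length (allF2^ k)
      ≡⟨ cong₂ _+_ (sumBy-*ˡ (length Xs) _ (allF2^ k)) (cong (withZeroFactor k e *_) (length-allF2^ k)) ⟩
    length Xs * count (not ∘ nonzeroᵇ) (allF2^ k) + withZeroFactor k e * 2 ^ k
      ≡⟨ cong₂ _+_ (cong₂ _*_ length-Xs only-0v-is-zero) (*-comm (withZeroFactor k e) _) ⟩
    (2 ^ k) ^ e * 1 + 2 ^ k * withZeroFactor k e
      ≡⟨ cong (_+ 2 ^ k * withZeroFactor k e) (*-identityʳ _) ⟩
    (2 ^ k) ^ e + 2 ^ k * withZeroFactor k e ∎
    where
    open ≤-Reasoning
    Xs = allVecs (allF2^ k) e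
    length-Xs : length Xs ≡ (2 ^ k) ^ e
    length-Xs = trans (length-allVecs (allF2^ k) e) (cong (_^ e) (length-allF2^ k))
    only-0v-is-zero : count (not ∘ nonzeroᵇ) (allF2^ k) ≡ 1
    only-0v-is-zero = trans (sumBy-cong (allF2^ k) (λ x → cong (𝟙 ∘ not) (nonzeroᵇ≡not[0v==] x)))
      (trans (sumBy-cong (allF2^ k) (λ x → cong 𝟙 (not-involutive _))) (M.mult≡1 (allF2^-enumerates k) 0v))
    𝟙-not-∧ : ∀ a b → 𝟙 (not (a ∧ b)) ≤ 𝟙 (not a) + 𝟙 (not b)
    𝟙-not-∧ true b = ≤-refl
    𝟙-not-∧ false b = m≤m+n 1 _

  withZeroFactor-bound : ∀ k e → withZeroFactor k (suc e) ≤ suc e * (2 ^ k) ^ e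
  withZeroFactor-bound k e = begin
    withZeroFactor k (suc e)                     ≤⟨ withZeroFactor-suc k e ⟩
    (2 ^ k) ^ e + 2 ^ k * withZeroFactor k e     ≡⟨ cong ((2 ^ k) ^ e +_) (*-comm (2 ^ k) _) ⟩
    (2 ^ k) ^ e + withZeroFactor k e * 2 ^ k     ≤⟨ +-monoʳ-≤ ((2 ^ k) ^ e) (scaled e) ⟩
    (2 ^ k) ^ e + e * (2 ^ k) ^ e                ∎
    where
    open ≤-Reasoning
    scaled : ∀ e → withZeroFactor k e * 2 ^ k ≤ e * (2 ^ k) ^ e
    scaled zero = z≤n
    scaled (suc e) = begin
      withZeroFactor k (suc e) * 2 ^ k                             ≤⟨ *-monoˡ-≤ (2 ^ k) (withZeroFactor-suc k e) ⟩
      ((2 ^ k) ^ e + 2 ^ k * withZeroFactor k e) * 2 ^ k           ≡⟨ expand ((2 ^ k) ^ e) (2 ^ k) (withZeroFactor k e) ⟩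
      (2 ^ k) ^ e * 2 ^ k + 2 ^ k * (withZeroFactor k e * 2 ^ k)   ≤⟨ +-monoʳ-≤ ((2 ^ k) ^ e * 2 ^ k) (*-monoʳ-≤ (2 ^ k) (scaled e)) ⟩
      (2 ^ k) ^ e * 2 ^ k + 2 ^ k * (e * (2 ^ k) ^ e)              ≡⟨ collect ((2 ^ k) ^ e) (2 ^ k) e ⟩
      suc e * (2 ^ k * (2 ^ k) ^ e)                                ∎
      where
      expand : ∀ a b z → (a + b * z) * b ≡ a * b + b * (z * b)
      expand = solve-∀
      collect : ∀ a b e → a * b + b * (e * a) ≡ (1 + e) * (b * a)
      collect = solve-∀

  largestRoot : ℕ → ℕ → ℕ → ℕ
  largestRoot K B zero = 0
  largestRoot K B (suc m) with suc m ^ K ≤? B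
  ... | yes _ = suc m
  ... | no _ = largestRoot K B m

  largestRoot-maximal : ∀ K B lim m → m ≤ lim → m ^ K ≤ B → m ≤ largestRoot K B lim
  largestRoot-maximal K B zero m m≤lim _ = m≤lim
  largestRoot-maximal K B (suc lim) m m≤lim mᴷ≤B with suc lim ^ K ≤? B
  ... | yes _ = m≤lim
  ... | no lim+1-too-big with m≤n⇒m<n∨m≡n m≤lim
  ...   | inj₁ m<lim+1 = largestRoot-maximal K B lim m (≤-pred m<lim+1) mᴷ≤B
  ...   | inj₂ refl = ⊥-elim (lim+1-too-big mᴷ≤B)

  largestRoot-^≤ : ∀ K B lim → 1 ≤ K → largestRoot K B lim ^ K ≤ B
  largestRoot-^≤ (suc K) B zero _ = z≤n
  largestRoot-^≤ K B (suc lim) 1≤K with suc lim ^ K ≤? B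
  ... | yes fits = fits
  ... | no _ = largestRoot-^≤ K B lim 1≤K

  -- The zero-factor tuples plus the K-th root of the bound 2^t ⋅ 2^(k e K) from nonzeroHits-bound, K = k^e.
  hitBound : ℕ → ℕ → ℕ → ℕ
  hitBound k e t = suc e * (2 ^ k) ^ e + largestRoot (k ^ e) (2 ^ t * 2 ^ (k * e * k ^ e)) ((2 ^ k) ^ suc e)

  hits-in-subspan≤ : ∀ k e t (S : F2^ t) (G : Vec (F2^ (k ^ suc e)) t) →
    count (λ xs → inSubspan S G (⨂ xs)) (allVecs (allF2^ k) (suc e)) ≤ hitBound k e t
  hits-in-subspan≤ k e t S G = begin
    count (λ xs → V (⨂ xs)) (allVecs (allF2^ k) (suc e))    ≤⟨ hits≤withZeroFactor+nonzeroHits k (suc e) V ⟩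
    withZeroFactor k (suc e) + nonzeroHits k (suc e) V      ≤⟨ +-mono-≤ (withZeroFactor-bound k e) nonzero≤root ⟩
    hitBound k e t                                          ∎
    where
    open ≤-Reasoning
    V = inSubspan S G
    nonzero≤root : nonzeroHits k (suc e) V ≤ largestRoot (k ^ e) (2 ^ t * 2 ^ (k * e * k ^ e)) ((2 ^ k) ^ suc e)
    nonzero≤root = largestRoot-maximal _ _ _ _ (nonzeroHits≤ k (suc e) V)
      (≤-trans (nonzeroHits-bound k e V (inSubspan-subspace S G)) (*-monoˡ-≤ (2 ^ (k * e * k ^ e)) (size-inSubspan≤ S G)))

module DimensionCount where

  open import Data.Nat hiding (_≟_)
  open import Data.Nat.Properties hiding (_≟_)
  open import Data.Nat.Combinatorics using (_C_; nCk+nC[k+1]≡[n+1]C[k+1])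
  open import Data.Bool using (Bool; true; false; _∧_)
  open import Data.Bool.Properties using (T-≡)
  open import Function using (Equivalence)
  open import Data.Bool.ListAction using (any)
  open import Data.List using (List; length)
  open import Data.Vec using (Vec; replicate; lookup; map)
  open import Data.Vec.Properties using (lookup-map)
  open import Data.Product using (_,_)
  open import Relation.Binary.PropositionalEquality
  open import Defs using (F2^; allBool; allVecs; card; dimSpan; tensors; countDim)
  open Counting
  open F2Vectors
  open TensorProduct
  open Flattening
  open SpanningSubset
  open CountingOutsideS
  open HitsInSpan
  private module M {n} = MultF2 {n}

  ≡⇒≡ᵇ≡true : ∀ {m n} → m ≡ n → (m ≡ᵇ n) ≡ true
  ≡⇒≡ᵇ≡true {m} {n} m≡n = Equivalence.to T-≡ (≡⇒≡ᵇ m n m≡n)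

  ≡ᵇ≡true⇒≡ : ∀ {m n} → (m ≡ᵇ n) ≡ true → m ≡ n
  ≡ᵇ≡true⇒≡ {m} {n} eq = ≡ᵇ⇒≡ m n (Equivalence.from T-≡ eq)

  count-card≡ : ∀ t r → count (λ S → card S ≡ᵇ r) (allF2^ t) ≡ t C r
  count-card≡ zero zero = refl
  count-card≡ zero (suc r) = refl
  count-card≡ (suc t) r = begin
    count (λ S → card S ≡ᵇ r) (allF2^ (suc t))
      ≡⟨ sumBy-allVecs-suc allBool t _ ⟩
    count (λ S → suc (card S) ≡ᵇ r) (allF2^ t) + (count (λ S → card S ≡ᵇ r) (allF2^ t) + 0)
      ≡⟨ cong (count (λ S → suc (card S) ≡ᵇ r) (allF2^ t) +_) (+-identityʳ _) ⟩
    count (λ S → suc (card S) ≡ᵇ r) (allF2^ t) + count (λ S → card S ≡ᵇ r) (allF2^ t)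
      ≡⟨ pascal r ⟩
    suc t C r ∎
    where
    open ≡-Reasoning
    pascal : ∀ r → count (λ S → suc (card S) ≡ᵇ r) (allF2^ t) + count (λ S → card S ≡ᵇ r) (allF2^ t) ≡ suc t C r
    pascal zero = trans (cong (_+ count (λ S → card S ≡ᵇ 0) (allF2^ t)) (sumBy-zero (allF2^ t))) (count-card≡ t zero)
    pascal (suc r) = trans (cong₂ _+_ (count-card≡ t r) (count-card≡ t (suc r))) (nCk+nC[k+1]≡[n+1]C[k+1] t r)

  module _ (e k t r : ℕ) where
    private
      d = suc e
      Rs : List (Vec (F2^ k) d)
      Rs = allVecs (allF2^ k) d
      x₀ : Vec (F2^ k) d
      x₀ = replicate d 0v

    -- Masking the coordinates outside S makes the spanning set depend on X only through S.
    goodᵇ : F2^ t → Vec (Vec (F2^ k) d) t → Bool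
    goodᵇ S X = allOutside S (λ x → inSubspan S (map ⨂ (mask S x₀ X)) (⨂ x)) X

    dimSpan≡r⇒good : ∀ X → dimSpan (tensors X) ≡ r → any (λ S → (card S ≡ᵇ r) ∧ goodᵇ S X) (allF2^ t) ≡ true
    dimSpan≡r⇒good X dim≡r with dimSpan-spanning-subset (tensors X) r dim≡r
    ... | S , card≡r , spans = any-intro _ (M.Enumerates⇒∈ (allF2^-enumerates t) S)
          (cong₂ _∧_ (≡⇒≡ᵇ≡true card≡r) (allOutside-intro S _ X outside-in-span))
      where
      outside-in-span : ∀ i → lookup S i ≡ false → inSubspan S (map ⨂ (mask S x₀ X)) (⨂ (lookup X i)) ≡ true
      outside-in-span i i∉S = trans (sym (inSubspan-mask ⨂ S x₀ X (⨂ (lookup X i))))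
        (subst₂ (λ G w → inSubspan S G w ≡ true) (flatten-tensors X)
          (trans (cong (λ G → lookup G i) (flatten-tensors X)) (lookup-map i ⨂ X)) (spans i i∉S))

    private
      Q = length Rs
      M = hitBound k e t

    count-good≤ : ∀ S → count (λ X → (card S ≡ᵇ r) ∧ goodᵇ S X) (allVecs Rs t) ≤ 𝟙 (card S ≡ᵇ r) * (Q ^ r * M ^ (t ∸ r))
    count-good≤ S with card S ≡ᵇ r in card≡
    ... | false = ≤-reflexive (sumBy-zero (allVecs Rs t))
    ... | true with ≡ᵇ≡true⇒≡ {card S} card≡
    ...   | refl = ≤-trans
            (count-allOutside≤ Rs x₀ M S (mask S x₀) (mask-dependsOnlyOn S x₀)
              (λ κ x → inSubspan S (map ⨂ κ) (⨂ x)) (λ κ → hits-in-subspan≤ k e t S (map ⨂ κ)))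
            (≤-reflexive (sym (+-identityʳ _)))

    countDim≤ : countDim d k t r ≤ (t C r) * (((2 ^ k) ^ d) ^ r * hitBound k e t ^ (t ∸ r))
    countDim≤ = begin
      countDim d k t r
        ≡⟨ length-filterᵇ _ (allVecs Rs t) ⟩
      count (λ X → dimSpan (tensors X) ≡ᵇ r) (allVecs Rs t)
        ≤⟨ sumBy-mono (allVecs Rs t) some-S-good ⟩
      count (λ X → any (λ S → (card S ≡ᵇ r) ∧ goodᵇ S X) (allF2^ t)) (allVecs Rs t)
        ≤⟨ union-bound (λ S X → (card S ≡ᵇ r) ∧ goodᵇ S X) (allF2^ t) (allVecs Rs t) ⟩
      sumBy (λ S → count (λ X → (card S ≡ᵇ r) ∧ goodᵇ S X) (allVecs Rs t)) (allF2^ t)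
        ≤⟨ sumBy-mono (allF2^ t) count-good≤ ⟩
      sumBy (λ S → 𝟙 (card S ≡ᵇ r) * W) (allF2^ t)
        ≡⟨ sumBy-cong (allF2^ t) (λ S → *-comm _ W) ⟩
      sumBy (λ S → W * 𝟙 (card S ≡ᵇ r)) (allF2^ t)
        ≡⟨ sumBy-*ˡ W _ (allF2^ t) ⟩
      W * count (λ S → card S ≡ᵇ r) (allF2^ t)
        ≡⟨ cong (W *_) (count-card≡ t r) ⟩
      W * (t C r)
        ≡⟨ *-comm W _ ⟩
      (t C r) * W
        ≡⟨ cong (λ q → (t C r) * (q ^ r * M ^ (t ∸ r))) Q≡ ⟩
      (t C r) * (((2 ^ k) ^ d) ^ r * M ^ (t ∸ r)) ∎
      where
      open ≤-Reasoning
      W = Q ^ r * M ^ (t ∸ r)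
      Q≡ : Q ≡ (2 ^ k) ^ d
      Q≡ = trans (length-allVecs (allF2^ k) d) (cong (_^ d) (length-allF2^ k))
      some-S-good : ∀ X → 𝟙 (dimSpan (tensors X) ≡ᵇ r) ≤ 𝟙 (any (λ S → (card S ≡ᵇ r) ∧ goodᵇ S X) (allF2^ t))
      some-S-good X with dimSpan (tensors X) ≡ᵇ r in dim≡
      ... | false = z≤n
      ... | true rewrite dimSpan≡r⇒good X (≡ᵇ≡true⇒≡ dim≡) = ≤-refl

module RationalEmbedding where

  open import Data.Nat as ℕ using (ℕ; zero; suc)
  import Data.Nat.Properties as ℕ
  open import Data.Integer as ℤ using (+_)
  import Data.Integer.Properties as ℤ
  open import Data.Rational using (0ℚ; _+_; _*_; _≤_; _<_; toℚᵘ; nonNegative; positive; _≤?_; *<*)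
  open import Data.Rational.Properties
  import Data.Rational.Unnormalised as U
  import Data.Rational.Unnormalised.Properties as U
  open import Data.Rational.Solver using (module +-*-Solver)
  open +-*-Solver using (solve; _:*_; _:=_)
  open import Relation.Nullary using (yes; no)
  open import Data.Empty using (⊥-elim)
  open import Data.Product using (_,_)
  open import Relation.Binary.PropositionalEquality
  open import Defs using (ℕ→ℚ; _^ℚ_)

  -- ℕ→ℚ n is fromℚᵘ of the unnormalised n / 1, which lets the homomorphism lemmas for toℚᵘ do the work.
  toℚᵘ-ℕ→ℚ : ∀ n → toℚᵘ (ℕ→ℚ n) U.≃ U.mkℚᵘ (+ n) 0
  toℚᵘ-ℕ→ℚ n = toℚᵘ-fromℚᵘ (U.mkℚᵘ (+ n) 0)

  ℕ→ℚ-+ : ∀ a b → ℕ→ℚ (a ℕ.+ b) ≡ ℕ→ℚ a + ℕ→ℚ b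
  ℕ→ℚ-+ a b = toℚᵘ-injective (U.≃-trans (toℚᵘ-ℕ→ℚ (a ℕ.+ b)) (U.≃-trans sum
    (U.≃-sym (U.≃-trans (toℚᵘ-homo-+ (ℕ→ℚ a) (ℕ→ℚ b)) (U.+-cong (toℚᵘ-ℕ→ℚ a) (toℚᵘ-ℕ→ℚ b))))))
    where
    sum : U.mkℚᵘ (+ (a ℕ.+ b)) 0 U.≃ U.mkℚᵘ (+ a) 0 U.+ U.mkℚᵘ (+ b) 0
    sum = U.*≡* (cong (ℤ._* + 1) (trans (ℤ.pos-+ a b) (sym (cong₂ ℤ._+_ (ℤ.*-identityʳ (+ a)) (ℤ.*-identityʳ (+ b))))))

  ℕ→ℚ-* : ∀ a b → ℕ→ℚ (a ℕ.* b) ≡ ℕ→ℚ a * ℕ→ℚ b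
  ℕ→ℚ-* a b = toℚᵘ-injective (U.≃-trans (toℚᵘ-ℕ→ℚ (a ℕ.* b)) (U.≃-trans product
    (U.≃-sym (U.≃-trans (toℚᵘ-homo-* (ℕ→ℚ a) (ℕ→ℚ b)) (U.*-cong (toℚᵘ-ℕ→ℚ a) (toℚᵘ-ℕ→ℚ b))))))
    where
    product : U.mkℚᵘ (+ (a ℕ.* b)) 0 U.≃ U.mkℚᵘ (+ a) 0 U.* U.mkℚᵘ (+ b) 0
    product = U.*≡* (cong (ℤ._* + 1) (ℤ.pos-* a b))

  ℕ→ℚ-^ : ∀ a n → ℕ→ℚ (a ℕ.^ n) ≡ ℕ→ℚ a ^ℚ n
  ℕ→ℚ-^ a zero = refl
  ℕ→ℚ-^ a (suc n) = trans (ℕ→ℚ-* a (a ℕ.^ n)) (cong (ℕ→ℚ a *_) (ℕ→ℚ-^ a n))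

  ℕ→ℚ-nonNeg : ∀ n → 0ℚ ≤ ℕ→ℚ n
  ℕ→ℚ-nonNeg n = nonNegative⁻¹ (ℕ→ℚ n) {{normalize-nonNeg n 1}}

  ℕ→ℚ-mono-≤ : ∀ {a b} → a ℕ.≤ b → ℕ→ℚ a ≤ ℕ→ℚ b
  ℕ→ℚ-mono-≤ {a} {b} a≤b with ℕ.m≤n⇒∃[o]m+o≡n a≤b
  ... | o , refl = begin
    ℕ→ℚ a            ≡⟨ +-identityʳ (ℕ→ℚ a) ⟨
    ℕ→ℚ a + 0ℚ       ≤⟨ +-monoʳ-≤ (ℕ→ℚ a) (ℕ→ℚ-nonNeg o) ⟩
    ℕ→ℚ a + ℕ→ℚ o    ≡⟨ ℕ→ℚ-+ a o ⟨
    ℕ→ℚ (a ℕ.+ o)    ∎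
    where open ≤-Reasoning

  ^ℚ-nonNeg : ∀ {x} n → 0ℚ ≤ x → 0ℚ ≤ x ^ℚ n
  ^ℚ-nonNeg zero _ = ℕ→ℚ-nonNeg 1
  ^ℚ-nonNeg {x} (suc n) 0≤x = begin
    0ℚ           ≡⟨ *-zeroʳ x ⟨
    x * 0ℚ       ≤⟨ *-monoˡ-≤-nonNeg x {{nonNegative 0≤x}} (^ℚ-nonNeg n 0≤x) ⟩
    x * x ^ℚ n   ∎
    where open ≤-Reasoning

  ^ℚ-pos : ∀ {x} n → 0ℚ < x → 0ℚ < x ^ℚ n
  ^ℚ-pos zero _ = *<* (ℤ.+<+ (ℕ.s≤s ℕ.z≤n))
  ^ℚ-pos {x} (suc n) 0<x = begin-strict
    0ℚ            ≡⟨ *-zeroˡ (x ^ℚ n) ⟨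
    0ℚ * x ^ℚ n   <⟨ *-monoˡ-<-pos (x ^ℚ n) {{positive (^ℚ-pos n 0<x)}} 0<x ⟩
    x * x ^ℚ n    ∎
    where open ≤-Reasoning

  ^ℚ-monoˡ-≤ : ∀ {x y} n → 0ℚ ≤ x → x ≤ y → x ^ℚ n ≤ y ^ℚ n
  ^ℚ-monoˡ-≤ zero _ _ = ≤-refl
  ^ℚ-monoˡ-≤ {x} {y} (suc n) 0≤x x≤y = begin
    x * x ^ℚ n   ≤⟨ *-monoʳ-≤-nonNeg (x ^ℚ n) {{nonNegative (^ℚ-nonNeg n 0≤x)}} x≤y ⟩
    y * x ^ℚ n   ≤⟨ *-monoˡ-≤-nonNeg y {{nonNegative (≤-trans 0≤x x≤y)}} (^ℚ-monoˡ-≤ n 0≤x x≤y) ⟩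
    y * y ^ℚ n   ∎
    where open ≤-Reasoning

  ^ℚ-monoˡ-< : ∀ {x y} n → 0ℚ ≤ x → x < y → x ^ℚ suc n < y ^ℚ suc n
  ^ℚ-monoˡ-< {x} {y} n 0≤x x<y = begin-strict
    x * x ^ℚ n   ≤⟨ *-monoˡ-≤-nonNeg x {{nonNegative 0≤x}} (^ℚ-monoˡ-≤ n 0≤x (<⇒≤ x<y)) ⟩
    x * y ^ℚ n   <⟨ *-monoˡ-<-pos (y ^ℚ n) {{positive (^ℚ-pos n (≤-<-trans 0≤x x<y))}} x<y ⟩
    y * y ^ℚ n   ∎
    where open ≤-Reasoning

  ^ℚ-cancelˡ-≤ : ∀ {x y} n → 1 ℕ.≤ n → 0ℚ ≤ y → x ^ℚ n ≤ y ^ℚ n → x ≤ y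
  ^ℚ-cancelˡ-≤ {x} {y} (suc n) _ 0≤y xⁿ≤yⁿ with x ≤? y
  ... | yes x≤y = x≤y
  ... | no x≰y = ⊥-elim (<-irrefl refl (<-≤-trans (^ℚ-monoˡ-< n 0≤y (≰⇒> x≰y)) xⁿ≤yⁿ))

  ^ℚ-distribˡ-* : ∀ x y n → (x * y) ^ℚ n ≡ x ^ℚ n * y ^ℚ n
  ^ℚ-distribˡ-* x y zero = refl
  ^ℚ-distribˡ-* x y (suc n) = trans (cong ((x * y) *_) (^ℚ-distribˡ-* x y n))
    (solve 4 (λ x y a b → (x :* y) :* (a :* b) := (x :* a) :* (y :* b)) refl x y (x ^ℚ n) (y ^ℚ n))

open import Defs
open import Data.Nat using (ℕ; _≤_; _∸_; _^_)
open import Data.Nat.Combinatorics using (_C_)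
open import Data.Rational using (ℚ; 0ℚ; _+_; _*_) renaming (_≤_ to _≤ℚ_)

import Data.Nat as ℕ
import Data.Nat.Properties as ℕ
open import Data.Rational using (nonNegative)
import Data.Rational.Properties as ℚ
open import Data.Rational.Solver using (module +-*-Solver)
open +-*-Solver using (solve; _:*_; _:=_)
open import Relation.Binary.PropositionalEquality
open Counting using (length-allVecs)
open F2Vectors using (length-allF2^)
open HitsInSpan using (hitBound; largestRoot; largestRoot-^≤)
open DimensionCount using (countDim≤)
open RationalEmbedding

-- From R^K ≤ 2^t P^K and 2^t ≤ b^K, the K-th root R is at most b P.
hitBound≤ : ∀ k e t (b : ℚ) → 1 ≤ k → 0ℚ ≤ℚ b → ℕ→ℚ (2 ^ t) ≤ℚ b ^ℚ (k ^ e) →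
  ℕ→ℚ (hitBound k e t) ≤ℚ (ℕ→ℚ (ℕ.suc e) + b) * ℕ→ℚ ((2 ^ k) ^ e)
hitBound≤ k e t b k≥1 b≥0 2^t≤bᴷ = begin
  ⟦ ℕ.suc e ℕ.* P ℕ.+ R ⟧           ≡⟨ trans (ℕ→ℚ-+ (ℕ.suc e ℕ.* P) R) (cong (_+ ⟦ R ⟧) (ℕ→ℚ-* (ℕ.suc e) P)) ⟩
  ⟦ ℕ.suc e ⟧ * ⟦ P ⟧ + ⟦ R ⟧       ≤⟨ ℚ.+-monoʳ-≤ (⟦ ℕ.suc e ⟧ * ⟦ P ⟧) R≤bP ⟩
  ⟦ ℕ.suc e ⟧ * ⟦ P ⟧ + b * ⟦ P ⟧   ≡⟨ ℚ.*-distribʳ-+ ⟦ P ⟧ ⟦ ℕ.suc e ⟧ b ⟨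
  (⟦ ℕ.suc e ⟧ + b) * ⟦ P ⟧         ∎
  where
  open ℚ.≤-Reasoning
  ⟦_⟧ = ℕ→ℚ
  K = k ^ e
  P = (2 ^ k) ^ e
  R = largestRoot K (2 ^ t ℕ.* 2 ^ (k ℕ.* e ℕ.* K)) ((2 ^ k) ^ ℕ.suc e)
  1≤K : 1 ≤ K
  1≤K = ℕ.m^n>0 k {{ℕ.>-nonZero k≥1}} e
  Pᴷ : P ^ K ≡ 2 ^ (k ℕ.* e ℕ.* K)
  Pᴷ = trans (cong (_^ K) (ℕ.^-*-assoc 2 k e)) (ℕ.^-*-assoc 2 (k ℕ.* e) K)
  Rᴷ≤ : R ^ K ≤ 2 ^ t ℕ.* P ^ K
  Rᴷ≤ = subst (λ n → R ^ K ≤ 2 ^ t ℕ.* n) (sym Pᴷ) (largestRoot-^≤ K _ ((2 ^ k) ^ ℕ.suc e) 1≤K)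
  bP≥0 : 0ℚ ≤ℚ b * ⟦ P ⟧
  bP≥0 = ℚ.≤-trans (ℚ.≤-reflexive (sym (ℚ.*-zeroˡ ⟦ P ⟧))) (ℚ.*-monoʳ-≤-nonNeg ⟦ P ⟧ {{nonNegative (ℕ→ℚ-nonNeg P)}} b≥0)
  R≤bP : ⟦ R ⟧ ≤ℚ b * ⟦ P ⟧
  R≤bP = ^ℚ-cancelˡ-≤ K 1≤K bP≥0 (begin
    ⟦ R ⟧ ^ℚ K                ≡⟨ ℕ→ℚ-^ R K ⟨
    ⟦ R ^ K ⟧                 ≤⟨ ℕ→ℚ-mono-≤ Rᴷ≤ ⟩
    ⟦ 2 ^ t ℕ.* P ^ K ⟧       ≡⟨ trans (ℕ→ℚ-* (2 ^ t) (P ^ K)) (cong (⟦ 2 ^ t ⟧ *_) (ℕ→ℚ-^ P K)) ⟩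
    ⟦ 2 ^ t ⟧ * ⟦ P ⟧ ^ℚ K    ≤⟨ ℚ.*-monoʳ-≤-nonNeg (⟦ P ⟧ ^ℚ K) {{nonNegative (^ℚ-nonNeg K (ℕ→ℚ-nonNeg P))}} 2^t≤bᴷ ⟩
    b ^ℚ K * ⟦ P ⟧ ^ℚ K       ≡⟨ ^ℚ-distribˡ-* b ⟦ P ⟧ K ⟨
    (b * ⟦ P ⟧) ^ℚ K          ∎)

rescale : ∀ c q a p m r s (x : ℚ) → ℕ→ℚ m ≤ℚ x * ℕ→ℚ p →
  ℕ→ℚ (c ℕ.* (q ^ r ℕ.* m ^ s)) * ℕ→ℚ a ^ℚ s ≤ℚ ℕ→ℚ c * ℕ→ℚ (q ^ r ℕ.* (a ℕ.* p) ^ s) * x ^ℚ s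
rescale c q a p m r s x m≤xp = begin
  ⟦ c ℕ.* (q ^ r ℕ.* m ^ s) ⟧ * A
    ≡⟨ cong (_* A) (trans (ℕ→ℚ-* c _) (cong (⟦ c ⟧ *_) (embed m))) ⟩
  ⟦ c ⟧ * (Q * ⟦ m ⟧ ^ℚ s) * A
    ≤⟨ ℚ.*-monoʳ-≤-nonNeg A {{nonNegative A≥0}} (ℚ.*-monoˡ-≤-nonNeg ⟦ c ⟧ {{nonNegative (ℕ→ℚ-nonNeg c)}}
         (ℚ.*-monoˡ-≤-nonNeg Q {{nonNegative Q≥0}} (^ℚ-monoˡ-≤ s (ℕ→ℚ-nonNeg m) m≤xp))) ⟩
  ⟦ c ⟧ * (Q * (x * ⟦ p ⟧) ^ℚ s) * A
    ≡⟨ cong (λ y → ⟦ c ⟧ * (Q * y) * A) (^ℚ-distribˡ-* x ⟦ p ⟧ s) ⟩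
  ⟦ c ⟧ * (Q * (X * ⟦ p ⟧ ^ℚ s)) * A
    ≡⟨ solve 5 (λ c Q X P A → c :* (Q :* (X :* P)) :* A := c :* (Q :* (A :* P)) :* X) refl ⟦ c ⟧ Q X (⟦ p ⟧ ^ℚ s) A ⟩
  ⟦ c ⟧ * (Q * (A * ⟦ p ⟧ ^ℚ s)) * X
    ≡⟨ cong (λ y → ⟦ c ⟧ * (Q * y) * X) (^ℚ-distribˡ-* ⟦ a ⟧ ⟦ p ⟧ s) ⟨
  ⟦ c ⟧ * (Q * (⟦ a ⟧ * ⟦ p ⟧) ^ℚ s) * X
    ≡⟨ cong (λ y → ⟦ c ⟧ * y * X) (trans (embed (a ℕ.* p)) (cong (λ y → Q * y ^ℚ s) (ℕ→ℚ-* a p))) ⟨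
  ⟦ c ⟧ * ⟦ q ^ r ℕ.* (a ℕ.* p) ^ s ⟧ * X ∎
  where
  open ℚ.≤-Reasoning
  ⟦_⟧ = ℕ→ℚ
  A = ⟦ a ⟧ ^ℚ s
  Q = ⟦ q ⟧ ^ℚ r
  X = x ^ℚ s
  A≥0 : 0ℚ ≤ℚ A
  A≥0 = ^ℚ-nonNeg s (ℕ→ℚ-nonNeg a)
  Q≥0 : 0ℚ ≤ℚ Q
  Q≥0 = ^ℚ-nonNeg r (ℕ→ℚ-nonNeg q)
  embed : ∀ n → ⟦ q ^ r ℕ.* n ^ s ⟧ ≡ Q * ⟦ n ⟧ ^ℚ s
  embed n = trans (ℕ→ℚ-* (q ^ r) (n ^ s)) (cong₂ _*_ (ℕ→ℚ-^ q r) (ℕ→ℚ-^ n s))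

numSamples≡ : ∀ d k t → numSamples d k t ≡ ((2 ^ k) ^ d) ^ t
numSamples≡ d k t = trans (length-allVecs _ t) (cong (_^ t) (trans (length-allVecs _ d) (cong (_^ d) (length-allF2^ k))))

corollary3p11 : (d k t : ℕ) → 1 ≤ d → 1 ≤ k → 1 ≤ t →
    (r : ℕ) → r ≤ t →
    -- for every rational b ≥ 2^{t / k^{d-1}}  (b ≥ 0 and b^{k^{d-1}} ≥ 2^t):
    (b : ℚ) → 0ℚ ≤ℚ b → ℕ→ℚ (2 ^ t) ≤ℚ (b ^ℚ (k ^ (d ∸ 1))) →
    -- Pr[dim = r] * (2^k)^{t-r} ≤ (t choose r) * (d + b)^{t-r}
    ℕ→ℚ (countDim d k t r) * (ℕ→ℚ (2 ^ k) ^ℚ (t ∸ r))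
      ≤ℚ ℕ→ℚ (t C r) * ℕ→ℚ (numSamples d k t) * ((ℕ→ℚ d + b) ^ℚ (t ∸ r))
corollary3p11 (ℕ.suc e) k t _ k≥1 _ r r≤t b b≥0 2^t≤bᴷ = begin
  ℕ→ℚ (countDim d k t r) * ℕ→ℚ (2 ^ k) ^ℚ s
    ≤⟨ ℚ.*-monoʳ-≤-nonNeg (ℕ→ℚ (2 ^ k) ^ℚ s) {{nonNegative (^ℚ-nonNeg s (ℕ→ℚ-nonNeg (2 ^ k)))}}
         (ℕ→ℚ-mono-≤ (countDim≤ e k t r)) ⟩
  ℕ→ℚ ((t C r) ℕ.* (Q ^ r ℕ.* hitBound k e t ^ s)) * ℕ→ℚ (2 ^ k) ^ℚ s
    ≤⟨ rescale (t C r) Q (2 ^ k) ((2 ^ k) ^ e) (hitBound k e t) r s X (hitBound≤ k e t b k≥1 b≥0 2^t≤bᴷ) ⟩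
  ℕ→ℚ (t C r) * ℕ→ℚ (Q ^ r ℕ.* Q ^ s) * X ^ℚ s
    ≡⟨ cong (λ n → ℕ→ℚ (t C r) * ℕ→ℚ n * X ^ℚ s) Qʳ⁺ˢ≡numSamples ⟩
  ℕ→ℚ (t C r) * ℕ→ℚ (numSamples d k t) * X ^ℚ s ∎
  where
  open ℚ.≤-Reasoning
  d = ℕ.suc e
  s = t ∸ r
  Q = (2 ^ k) ^ d
  X = ℕ→ℚ d + b
  Qʳ⁺ˢ≡numSamples : Q ^ r ℕ.* Q ^ s ≡ numSamples d k t
  Qʳ⁺ˢ≡numSamples = trans (sym (ℕ.^-distribˡ-+-* Q r s)) (trans (cong (Q ^_) (ℕ.m+[n∸m]≡n r≤t)) (sym (numSamples≡ d k t)))
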